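{- Let $l\ge 1$, $q$ a prime power, $\lambda$ a generator of $GF(q)^*$, and let $A=I+e_{1,2}$, $B$ the $(l+1)\times(l+1)$ matrix with entries $1$ in positions $(i+1,i)$ for $1\le i\le l$, entry $(-1)^l$ in position $(1,l+1)$ and $0$ elsewhere, and $C=\mathrm{diag}(\lambda^{ -1},\lambda,1,\dots,1)$, all over $GF(q)$. Let $\Gamma=\mathrm{Cay}\big(SL(l+1,q),\{A,A^{ -1},B,B^{ -1},C,C^{ -1}\}\big)$. Let $S_0=\left\{\begin{pmatrix} D&0\\0&1\end{pmatrix} : D\in SL(l,q)\right\}$ and $S=\bigcup_{i=0}^{l-1}S_0B^i$. Then $\frac{|\partial S|}{|S|}\le\frac{6}{l}$, where $\partial S$ is the boundary of $S$ in $\Gamma$.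
   Context: $e_{i,j}$ denotes the matrix with $1$ in position $(i,j)$ and $0$ elsewhere; $I$ is the identity matrix. Cayley graph $\mathrm{Cay}(G,T)$: vertex set $G$, $g\sim h$ iff $g^{ -1}h\in T$. $\partial S$ is the set of vertices outside $S$ having a neighbour in $S$. -}

module Defs where

open import Level using (0ℓ)
open import Data.Nat as ℕ using (ℕ; zero; suc)
open import Data.Bool using (Bool; true; false; if_then_else_; _∧_)
open import Data.Fin using (Fin; toℕ)
import Data.Fin as Fin
open import Data.Vec using (Vec; []; _∷_; lookup; tabulate; removeAt; _∷ʳ_; replicate; map)
open import Data.List using (List)
open import Data.List.Membership.Propositional using (_∈_)
open import Data.Product using (Σ; ∃; ∃-syntax; _×_; _,_)
open import Data.Sum using (_⊎_)
open import Relation.Binary.PropositionalEquality using (_≡_; _≢_)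
open import Relation.Binary.Definitions using (DecidableEquality)
open import Relation.Nullary using (¬_)
open import Algebra.Structures using (IsCommutativeRing)

-- A finite field, with propositional equality on the carrier.
-- (Finite fields are exactly the GF(q), q a prime power, q = number of elements.)
record FiniteField : Set₁ where
  infixl 7 _*_
  infixl 6 _+_
  field
    Carrier : Set
    _+_ _*_ : Carrier → Carrier → Carrier
    -_      : Carrier → Carrier
    0# 1#   : Carrier
    _⁻¹     : Carrier → Carrier
    isCommutativeRing : IsCommutativeRing _≡_ _+_ _*_ -_ 0# 1#
    0≢1     : 0# ≢ 1#
    inverseʳ : ∀ x → x ≢ 0# → x * (x ⁻¹) ≡ 1#
    _≟_     : DecidableEquality Carrier
    elements : List Carrier
    complete : ∀ x → x ∈ elements

module FF (F : FiniteField) where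
  open FiniteField F

  _^_ : Carrier → ℕ → Carrier
  x ^ zero  = 1#
  x ^ suc k = x * (x ^ k)

  IsGenerator : Carrier → Set
  IsGenerator g = ∀ x → x ≢ 0# → ∃[ k ] (g ^ k ≡ x)

  Mat : ℕ → Set
  Mat n = Vec (Vec Carrier n) n

  entry : ∀ {n} → Mat n → Fin n → Fin n → Carrier
  entry M i j = lookup (lookup M i) j

  fromFun : ∀ {n} → (ℕ → ℕ → Carrier) → Mat n
  fromFun f = tabulate λ i → tabulate λ j → f (toℕ i) (toℕ j)

  sumFin : ∀ {n} → (Fin n → Carrier) → Carrier
  sumFin {zero}  f = 0#
  sumFin {suc n} f = f Fin.zero + sumFin (λ i → f (Fin.suc i))

  _⊗_ : ∀ {n} → Mat n → Mat n → Mat n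
  M ⊗ N = tabulate λ i → tabulate λ j → sumFin λ k → entry M i k * entry N k j

  I : ∀ {n} → Mat n
  I = fromFun λ i j → if i ℕ.≡ᵇ j then 1# else 0#

  _^ᴹ_ : ∀ {n} → Mat n → ℕ → Mat n
  M ^ᴹ zero  = I
  M ^ᴹ suc k = M ⊗ (M ^ᴹ k)

  sgn : ℕ → Carrier
  sgn zero = 1#
  sgn (suc j) = - sgn j

  det : ∀ {n} → Mat n → Carrier
  det {zero}  []       = 1#
  det {suc n} (r ∷ rs) =
    sumFin λ j → sgn (toℕ j) * lookup r j * det (map (λ row → removeAt row j) rs)

  InSL : ∀ {n} → Mat n → Set
  InSL M = det M ≡ 1#

  -- the generators, as (l+1)×(l+1) matrices (0-based indices here)
  -- A = I + e_{1,2}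
  matA : (l : ℕ) → Mat (suc l)
  matA l = fromFun λ i j →
    if i ℕ.≡ᵇ j then 1# else (if (i ℕ.≡ᵇ 0) ∧ (j ℕ.≡ᵇ 1) then 1# else 0#)

  matB : (l : ℕ) → Mat (suc l)
  matB l = fromFun λ i j →
    if i ℕ.≡ᵇ suc j then 1# else (if (i ℕ.≡ᵇ 0) ∧ (j ℕ.≡ᵇ l) then sgn l else 0#)

  matC : (l : ℕ) → Carrier → Mat (suc l)
  matC l g = fromFun λ i j →
    if i ℕ.≡ᵇ j
      then (if i ℕ.≡ᵇ 0 then g ⁻¹ else (if i ℕ.≡ᵇ 1 then g else 1#))
      else 0#

  -- the generating set T = {A, A⁻¹, B, B⁻¹, C, C⁻¹}; X⁻¹ is the matrix t with t X = I
  InT : (l : ℕ) → Carrier → Mat (suc l) → Set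
  InT l g t = (t ≡ matA l) ⊎ (t ≡ matB l) ⊎ (t ≡ matC l g)
            ⊎ ((t ⊗ matA l) ≡ I) ⊎ ((t ⊗ matB l) ≡ I) ⊎ ((t ⊗ matC l g) ≡ I)

  -- adjacency in Cay(SL(l+1,q), T): g ~ h iff g⁻¹h ∈ T, i.e. h = g t with t ∈ T
  Adj : (l : ℕ) → Carrier → Mat (suc l) → Mat (suc l) → Set
  Adj l g M N = ∃[ t ] (InT l g t × (M ⊗ t) ≡ N)

  -- block matrix diag(D, 1)
  embed : ∀ {l} → Mat l → Mat (suc l)
  embed {l} D = map (λ row → row ∷ʳ 0#) D ∷ʳ (replicate l 0# ∷ʳ 1#)

  InS₀ : (l : ℕ) → Mat (suc l) → Set
  InS₀ l M = ∃[ D ] (InSL {l} D × M ≡ embed D)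

  InS : (l : ℕ) → Mat (suc l) → Set
  InS l M = ∃[ i ] (i ℕ.< l × ∃[ N ] (InS₀ l N × M ≡ (N ⊗ (matB l ^ᴹ i))))

  InBoundary : (l : ℕ) → Carrier → Mat (suc l) → Set
  InBoundary l g M = InSL M × ¬ InS l M × ∃[ N ] (InS l N × Adj l g M N)

module Submission where

-- Every boundary vertex M is joined by a generator t to some N = diag(D, 1) B^i in S, so
-- M = diag(D, 1) B^i t⁻¹. If t = A^{±1} or C^{±1}, then t⁻¹ is a unimodular 2 × 2 block at
-- rows 0, 1, which B^i moves to rows i, i + 1: for i + 1 < l this block lies inside the top-left
-- l × l corner and M is again in S. If t = B^{±1}, M = diag(D, 1) B^(i ∓ 1) is in S unless i = 0
-- or i = l − 1. So M = diag(D, 1) P for one of six fixed matrices P. The last row of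
-- diag(D, 1) B^j is a unit vector determined by j, hence the cosets S₀ B^j (j < l) are disjoint
-- and (j, M) ↦ (P, diag(D, 1) B^j) is an injection of [l] × ∂S into [6] × S.

open import Level using (0ℓ)
open import Algebra.Bundles using (CommutativeRing)
open import Data.Bool using (if_then_else_; _∧_)
open import Data.Empty using (⊥-elim)
open import Data.Fin as Fin using (Fin; toℕ; fromℕ<)
open import Data.Fin.Patterns using (0F; 1F; 2F; 3F; 4F; 5F)
import Data.Fin.Properties as Finₚ
import Data.List as List
open import Data.List.Membership.Propositional.Properties using (∈-lookup)
open import Data.List.Membership.Setoid.Properties using (index-injective)
open import Data.List.Relation.Unary.All as All using (All)
open import Data.List.Relation.Unary.AllPairs using (_∷_)
open import Data.List.Relation.Unary.Unique.Propositional using (Unique)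
import Data.List.Relation.Unary.Any as Any
open import Data.Nat as ℕ using (ℕ; zero; suc; _<_; _≤_; _∸_; z≤n; s≤s)
import Data.Nat.Properties as ℕₚ
open import Data.Product using (∃-syntax; _×_; _,_; proj₁; proj₂; uncurry)
open import Data.Sum using (_⊎_; inj₁; inj₂)
open import Data.Vec using (Vec; []; _∷_; _∷ʳ_; lookup; tabulate; map; removeAt; replicate)
import Data.Vec.Properties as Vecₚ
open import Function using (_∘_; flip)
open import Function.Bundles using (Equivalence)
open import Relation.Binary.PropositionalEquality
open import Relation.Nullary using (¬_; yes; no; contradiction)
open import Defs

lookup-injective : ∀ {A : Set} {xs : List.List A} → Unique xs → ∀ i j → List.lookup xs i ≡ List.lookup xs j → i ≡ j
lookup-injective (_   ∷ _)  Fin.zero Fin.zero _  = refl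
lookup-injective (x∉ ∷ _)  Fin.zero (Fin.suc j) eq = contradiction eq (All.lookup x∉ (∈-lookup j))
lookup-injective (x∉ ∷ _)  (Fin.suc i) Fin.zero eq = contradiction (sym eq) (All.lookup x∉ (∈-lookup i))
lookup-injective (_  ∷ xs) (Fin.suc i) (Fin.suc j) eq = cong Fin.suc (lookup-injective xs i j eq)

*-≤-from-injection : ∀ {a b m k} (f : Fin a → Fin b → Fin m) (h : Fin a → Fin b → Fin k) →
                     (∀ {x y x′ y′} → f x y ≡ f x′ y′ → h x y ≡ h x′ y′ → x ≡ x′ × y ≡ y′) →
                     a ℕ.* b ≤ m ℕ.* k
*-≤-from-injection {a} {b} f h injective = Finₚ.injective⇒≤ φ-injective
  where
  φ : Fin (a ℕ.* b) → Fin _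
  φ z = Fin.combine (uncurry f (Fin.remQuot {a} b z)) (uncurry h (Fin.remQuot {a} b z))
  φ-injective : ∀ {z z′} → φ z ≡ φ z′ → z ≡ z′
  φ-injective {z} {z′} φz≡φz′ = begin
    z                                  ≡⟨ Finₚ.combine-remQuot {a} b z ⟨
    uncurry Fin.combine (Fin.remQuot {a} b z)  ≡⟨ cong (uncurry Fin.combine) (cong₂ _,_ x≡x′ y≡y′) ⟩
    uncurry Fin.combine (Fin.remQuot {a} b z′) ≡⟨ Finₚ.combine-remQuot {a} b z′ ⟩
    z′                                 ∎
    where
    open ≡-Reasoning
    parts = Finₚ.combine-injective _ _ _ _ φz≡φz′
    x≡x′ = proj₁ (injective (proj₁ parts) (proj₂ parts))
    y≡y′ = proj₂ (injective (proj₁ parts) (proj₂ parts))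

module Matrices (F : FiniteField) where
  open FiniteField F
  open FF F

  ring : CommutativeRing 0ℓ 0ℓ
  ring = record { isCommutativeRing = isCommutativeRing }

  open CommutativeRing ring public
    using (+-assoc; +-comm; +-identityˡ; +-identityʳ; *-assoc; *-comm; *-identityˡ; *-identityʳ;
           distribˡ; distribʳ; zeroˡ; zeroʳ; -‿inverseˡ; -‿inverseʳ)
  open import Algebra.Properties.Ring (CommutativeRing.ring ring)
    using (-‿distribˡ-*; -‿distribʳ-*; -‿involutive)
  open import Algebra.Properties.CommutativeSemigroup (CommutativeRing.*-commutativeSemigroup ring)
    using (x∙yz≈y∙xz)
  open import Algebra.Properties.CommutativeSemigroup (CommutativeRing.+-commutativeSemigroup ring)
    using (interchange)
  open import Algebra.Properties.Semiring.Sum (CommutativeRing.semiring ring)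
    using (sum; sum-cong-≗; sum-replicate-zero; ∑-distrib-+; ∑-comm; *-distribˡ-sum; *-distribʳ-sum)

  -- Opaque, so that unification can recover the summand h from ∑ n h.
  opaque
    ∑ : ℕ → (ℕ → Carrier) → Carrier
    ∑ n h = sum {n} (λ k → h (toℕ k))

    sumFin≡∑ : ∀ n {f : Fin n → Carrier} {h : ℕ → Carrier} → (∀ k → f k ≡ h (toℕ k)) → sumFin f ≡ ∑ n h
    sumFin≡∑ zero    f≗h = refl
    sumFin≡∑ (suc n) {f} {h} f≗h = cong₂ _+_ (f≗h Fin.zero) (sumFin≡∑ n {f ∘ Fin.suc} {h ∘ suc} (f≗h ∘ Fin.suc))

    *-distribˡ-∑ : ∀ n a {h : ℕ → Carrier} → a * ∑ n h ≡ ∑ n (λ k → a * h k)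
    *-distribˡ-∑ n a {h} = *-distribˡ-sum {n} a (λ k → h (toℕ k))

    *-distribʳ-∑ : ∀ n a {h : ℕ → Carrier} → ∑ n h * a ≡ ∑ n (λ k → h k * a)
    *-distribʳ-∑ n a {h} = *-distribʳ-sum {n} a (λ k → h (toℕ k))

    ∑-+ : ∀ n (h h′ : ℕ → Carrier) → ∑ n (λ k → h k + h′ k) ≡ ∑ n h + ∑ n h′
    ∑-+ n h h′ = ∑-distrib-+ {n} (λ k → h (toℕ k)) (λ k → h′ (toℕ k))

    ∑-swap : ∀ m n (f : ℕ → ℕ → Carrier) → ∑ m (λ i → ∑ n (f i)) ≡ ∑ n (λ j → ∑ m (λ i → f i j))
    ∑-swap m n f = ∑-comm {m} {n} (λ i j → f (toℕ i) (toℕ j))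

    ∑-cong : ∀ n {h h′ : ℕ → Carrier} → (∀ k → k < n → h k ≡ h′ k) → ∑ n h ≡ ∑ n h′
    ∑-cong n h≗h′ = sum-cong-≗ (λ k → h≗h′ (toℕ k) (Finₚ.toℕ<n k))

    ∑-zero : ∀ n {h : ℕ → Carrier} → (∀ k → k < n → h k ≡ 0#) → ∑ n h ≡ 0#
    ∑-zero n h≡0 = trans (∑-cong n h≡0) (sum-replicate-zero n)

    ∑-single : ∀ n {h : ℕ → Carrier} {k₀} → k₀ < n →
               (∀ k → k < n → k ≢ k₀ → h k ≡ 0#) → ∑ n h ≡ h k₀
    ∑-single (suc n) {k₀ = zero} _ h≡0 =
      trans (cong (_ +_) (∑-zero n (λ k k<n → h≡0 (suc k) (s≤s k<n) λ ()))) (+-identityʳ _)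
    ∑-single (suc n) {k₀ = suc k₀} (s≤s k₀<n) h≡0 =
      trans (cong₂ _+_ (h≡0 0 (s≤s z≤n) λ ())
                       (∑-single n k₀<n λ k k<n k≢k₀ → h≡0 (suc k) (s≤s k<n) (k≢k₀ ∘ ℕₚ.suc-injective)))
            (+-identityˡ _)

    ∑-pair : ∀ n {h : ℕ → Carrier} {k₀} → suc k₀ < n →
             (∀ k → k < n → k ≢ k₀ → k ≢ suc k₀ → h k ≡ 0#) → ∑ n h ≡ h k₀ + h (suc k₀)
    ∑-pair (suc n) {k₀ = zero} 1<n h≡0 =
      cong (_ +_) (∑-single n (ℕ.s<s⁻¹ 1<n) λ k k<n k≢0 →
        h≡0 (suc k) (s≤s k<n) (λ ()) (k≢0 ∘ ℕₚ.suc-injective))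
    ∑-pair (suc n) {k₀ = suc k₀} (s≤s k₀<n) h≡0 =
      trans (cong₂ _+_ (h≡0 0 (s≤s z≤n) (λ ()) (λ ()))
                       (∑-pair n k₀<n λ k k<n k≢k₀ k≢sk₀ →
                         h≡0 (suc k) (s≤s k<n) (k≢k₀ ∘ ℕₚ.suc-injective) (k≢sk₀ ∘ ℕₚ.suc-injective)))
            (+-identityˡ _)

    ∑-cong-pair : ∀ n {h h′ : ℕ → Carrier} {k₀} → suc k₀ < n →
                  (∀ k → k < n → k ≢ k₀ → k ≢ suc k₀ → h k ≡ h′ k) →
                  h k₀ + h (suc k₀) ≡ h′ k₀ + h′ (suc k₀) → ∑ n h ≡ ∑ n h′
    ∑-cong-pair (suc zero) {k₀ = zero} (s≤s ()) _ _
    ∑-cong-pair (suc (suc n)) {h} {h′} {zero} _ h≗h′ pair =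
      trans (sym (+-assoc (h 0) (h 1) _))
            (trans (cong₂ _+_ pair (∑-cong n λ k k<n → h≗h′ (suc (suc k)) (s≤s (s≤s k<n)) (λ ()) (λ ())))
                   (+-assoc (h′ 0) (h′ 1) _))
    ∑-cong-pair (suc n) {k₀ = suc k₀} sk₀<n h≗h′ pair =
      cong₂ _+_ (h≗h′ 0 (s≤s z≤n) (λ ()) (λ ()))
                (∑-cong-pair n (ℕ.s<s⁻¹ sk₀<n)
                  (λ k k<n k≢k₀ k≢sk₀ → h≗h′ (suc k) (s≤s k<n) (k≢k₀ ∘ ℕₚ.suc-injective)
                                                                (k≢sk₀ ∘ ℕₚ.suc-injective))
                  pair)

    ∑-snoc : ∀ n (h : ℕ → Carrier) → ∑ (suc n) h ≡ ∑ n h + h n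
    ∑-snoc zero    h = trans (+-identityʳ _) (sym (+-identityˡ _))
    ∑-snoc (suc n) h = trans (cong (h 0 +_) (∑-snoc n (h ∘ suc))) (sym (+-assoc _ _ _))

  -- Coefficients indexed by ℕ and zero outside the matrix, so that index arithmetic stays in ℕ.
  opaque
    coeff : ∀ {n} → Mat n → ℕ → ℕ → Carrier
    coeff {n} M i j with i ℕ.<? n | j ℕ.<? n
    ... | yes i<n | yes j<n = entry M (fromℕ< i<n) (fromℕ< j<n)
    ... | _       | _       = 0#

    coeff-< : ∀ {n} (M : Mat n) {i j} (i<n : i < n) (j<n : j < n) →
              coeff M i j ≡ entry M (fromℕ< i<n) (fromℕ< j<n)
    coeff-< {n} M {i} {j} i<n j<n with i ℕ.<? n | j ℕ.<? n
    ... | yes _    | yes _    = refl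
    ... | no i≮n   | _        = contradiction i<n i≮n
    ... | yes _    | no j≮n   = contradiction j<n j≮n

  coeff-toℕ : ∀ {n} (M : Mat n) i j → coeff M (toℕ i) (toℕ j) ≡ entry M i j
  coeff-toℕ M i j = trans (coeff-< M (Finₚ.toℕ<n i) (Finₚ.toℕ<n j))
                          (cong₂ (entry M) (Finₚ.fromℕ<-toℕ i _) (Finₚ.fromℕ<-toℕ j _))

  coeff-ext : ∀ {n} {M N : Mat n} → (∀ i j → i < n → j < n → coeff M i j ≡ coeff N i j) → M ≡ N
  coeff-ext {n} {M} {N} M≗N = begin
    M                                         ≡⟨ tabulate-entry M ⟨
    tabulate (λ i → tabulate (λ j → entry M i j)) ≡⟨ Vecₚ.tabulate-cong (λ i → Vecₚ.tabulate-cong (entry-≗ i)) ⟩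
    tabulate (λ i → tabulate (λ j → entry N i j)) ≡⟨ tabulate-entry N ⟩
    N                                         ∎
    where
    open ≡-Reasoning
    tabulate-entry : (M : Mat n) → tabulate (λ i → tabulate (λ j → entry M i j)) ≡ M
    tabulate-entry M = trans (Vecₚ.tabulate-cong λ i → Vecₚ.tabulate∘lookup (lookup M i)) (Vecₚ.tabulate∘lookup M)
    entry-≗ : ∀ i j → entry M i j ≡ entry N i j
    entry-≗ i j = trans (sym (coeff-toℕ M i j))
                        (trans (M≗N _ _ (Finₚ.toℕ<n i) (Finₚ.toℕ<n j)) (coeff-toℕ N i j))

  coeff-fromFun : ∀ {n} (f : ℕ → ℕ → Carrier) {i j} → i < n → j < n → coeff {n} (fromFun f) i j ≡ f i j
  coeff-fromFun {n} f {i} {j} i<n j<n = begin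
    coeff (fromFun {n} f) i j                     ≡⟨ coeff-< (fromFun f) i<n j<n ⟩
    lookup (lookup (fromFun {n} f) (fromℕ< i<n)) (fromℕ< j<n)
      ≡⟨ cong (λ row → lookup row (fromℕ< j<n)) (Vecₚ.lookup∘tabulate _ (fromℕ< i<n)) ⟩
    lookup (tabulate (λ j′ → f (toℕ (fromℕ< i<n)) (toℕ j′))) (fromℕ< j<n)
      ≡⟨ Vecₚ.lookup∘tabulate _ (fromℕ< j<n) ⟩
    f (toℕ (fromℕ< i<n)) (toℕ (fromℕ< j<n))     ≡⟨ cong₂ f (Finₚ.toℕ-fromℕ< i<n) (Finₚ.toℕ-fromℕ< j<n) ⟩
    f i j                                         ∎
    where open ≡-Reasoning

  coeff-⊗ : ∀ {n} (M N : Mat n) {i j} → i < n → j < n →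
            coeff (M ⊗ N) i j ≡ ∑ n (λ k → coeff M i k * coeff N k j)
  coeff-⊗ {n} M N {i} {j} i<n j<n = begin
    coeff (M ⊗ N) i j ≡⟨ coeff-< (M ⊗ N) i<n j<n ⟩
    lookup (lookup (M ⊗ N) (fromℕ< i<n)) (fromℕ< j<n)
      ≡⟨ cong (λ row → lookup row (fromℕ< j<n)) (Vecₚ.lookup∘tabulate _ (fromℕ< i<n)) ⟩
    lookup (tabulate _) (fromℕ< j<n) ≡⟨ Vecₚ.lookup∘tabulate _ (fromℕ< j<n) ⟩
    sumFin (λ k → entry M (fromℕ< i<n) k * entry N k (fromℕ< j<n)) ≡⟨ sumFin≡∑ n term ⟩
    ∑ n (λ k → coeff M i k * coeff N k j) ∎
    where
    open ≡-Reasoning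
    term : ∀ k → entry M (fromℕ< i<n) k * entry N k (fromℕ< j<n) ≡ coeff M i (toℕ k) * coeff N (toℕ k) j
    term k = sym (cong₂ _*_ (trans (coeff-< M i<n (Finₚ.toℕ<n k)) (cong (entry M _) (Finₚ.fromℕ<-toℕ k _)))
                            (trans (coeff-< N (Finₚ.toℕ<n k) j<n) (cong (λ k′ → entry N k′ _) (Finₚ.fromℕ<-toℕ k _))))

  module _ {n} (X Y : Mat n) {i j} (i<n : i < n) (j<n : j < n) where

    coeff-⊗-sparseRow : ∀ {m₀} → m₀ < n → (∀ m → m < n → m ≢ m₀ → coeff X i m ≡ 0#) →
                        coeff (X ⊗ Y) i j ≡ coeff X i m₀ * coeff Y m₀ j
    coeff-⊗-sparseRow m₀<n X≡0 = trans (coeff-⊗ X Y i<n j<n)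
      (∑-single n m₀<n λ m m<n m≢m₀ → trans (cong (_* coeff Y m j) (X≡0 m m<n m≢m₀)) (zeroˡ _))

    coeff-⊗-sparseColumn : ∀ {m₀} → m₀ < n → (∀ m → m < n → m ≢ m₀ → coeff Y m j ≡ 0#) →
                           coeff (X ⊗ Y) i j ≡ coeff X i m₀ * coeff Y m₀ j
    coeff-⊗-sparseColumn m₀<n Y≡0 = trans (coeff-⊗ X Y i<n j<n)
      (∑-single n m₀<n λ m m<n m≢m₀ → trans (cong (coeff X i m *_) (Y≡0 m m<n m≢m₀)) (zeroʳ _))

    coeff-⊗-pairColumn : ∀ {k} → suc k < n → (∀ m → m < n → m ≢ k → m ≢ suc k → coeff Y m j ≡ 0#) →
                         coeff (X ⊗ Y) i j ≡ coeff X i k * coeff Y k j + coeff X i (suc k) * coeff Y (suc k) j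
    coeff-⊗-pairColumn sk<n Y≡0 = trans (coeff-⊗ X Y i<n j<n)
      (∑-pair n sk<n λ m m<n m≢k m≢sk → trans (cong (coeff X i m *_) (Y≡0 m m<n m≢k m≢sk)) (zeroʳ _))

  ⊗-assoc : ∀ {n} (M N P : Mat n) → (M ⊗ N) ⊗ P ≡ M ⊗ (N ⊗ P)
  ⊗-assoc {n} M N P = coeff-ext λ i j i<n j<n → begin
    coeff ((M ⊗ N) ⊗ P) i j
      ≡⟨ coeff-⊗ (M ⊗ N) P i<n j<n ⟩
    ∑ n (λ k → coeff (M ⊗ N) i k * coeff P k j)
      ≡⟨ ∑-cong n (λ k k<n → cong (_* coeff P k j) (coeff-⊗ M N i<n k<n)) ⟩
    ∑ n (λ k → ∑ n (λ m → coeff M i m * coeff N m k) * coeff P k j)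
      ≡⟨ ∑-cong n (λ k _ → *-distribʳ-∑ n (coeff P k j)) ⟩
    ∑ n (λ k → ∑ n (λ m → coeff M i m * coeff N m k * coeff P k j))
      ≡⟨ ∑-swap n n _ ⟩
    ∑ n (λ m → ∑ n (λ k → coeff M i m * coeff N m k * coeff P k j))
      ≡⟨ ∑-cong n (λ m _ → trans (∑-cong n λ k _ → *-assoc _ _ _) (sym (*-distribˡ-∑ n (coeff M i m)))) ⟩
    ∑ n (λ m → coeff M i m * ∑ n (λ k → coeff N m k * coeff P k j))
      ≡⟨ ∑-cong n (λ m m<n → cong (coeff M i m *_) (sym (coeff-⊗ N P m<n j<n))) ⟩
    ∑ n (λ m → coeff M i m * coeff (N ⊗ P) m j)
      ≡⟨ coeff-⊗ M (N ⊗ P) i<n j<n ⟨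
    coeff (M ⊗ (N ⊗ P)) i j ∎
    where open ≡-Reasoning

  if-≡ᵇ-yes : ∀ {A : Set} {m n} {x y : A} → m ≡ n → (if m ℕ.≡ᵇ n then x else y) ≡ x
  if-≡ᵇ-yes {m = zero}  refl = refl
  if-≡ᵇ-yes {m = suc m} refl = if-≡ᵇ-yes {m = m} refl

  if-≡ᵇ-no : ∀ {A : Set} {m n} {x y : A} → m ≢ n → (if m ℕ.≡ᵇ n then x else y) ≡ y
  if-≡ᵇ-no {m = zero}  {zero}  m≢n = contradiction refl m≢n
  if-≡ᵇ-no {m = zero}  {suc n} _   = refl
  if-≡ᵇ-no {m = suc m} {zero}  _   = refl
  if-≡ᵇ-no {m = suc m} {suc n} m≢n = if-≡ᵇ-no (m≢n ∘ cong suc)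

  δ : ℕ → ℕ → Carrier
  δ i j = if i ℕ.≡ᵇ j then 1# else 0#

  δ-refl : ∀ i → δ i i ≡ 1#
  δ-refl i = if-≡ᵇ-yes {m = i} refl

  δ-≢ : ∀ {i j} → i ≢ j → δ i j ≡ 0#
  δ-≢ = if-≡ᵇ-no

  δ-sym : ∀ i j → δ i j ≡ δ j i
  δ-sym i j with i ℕ.≟ j
  ... | yes refl = refl
  ... | no i≢j   = trans (δ-≢ i≢j) (sym (δ-≢ (i≢j ∘ sym)))

  coeff-I : ∀ {n i j} → i < n → j < n → coeff {n} I i j ≡ δ i j
  coeff-I = coeff-fromFun δ

  ⊗-identityˡ : ∀ {n} (M : Mat n) → I ⊗ M ≡ M
  ⊗-identityˡ {n} M = coeff-ext λ i j i<n j<n → begin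
    coeff (I ⊗ M) i j         ≡⟨ coeff-⊗-sparseRow I M i<n j<n i<n (λ k k<n k≢i →
                                   trans (coeff-I i<n k<n) (δ-≢ (k≢i ∘ sym))) ⟩
    coeff I i i * coeff M i j ≡⟨ cong (_* coeff M i j) (trans (coeff-I i<n i<n) (δ-refl i)) ⟩
    1# * coeff M i j          ≡⟨ *-identityˡ _ ⟩
    coeff M i j               ∎
    where open ≡-Reasoning

  ⊗-identityʳ : ∀ {n} (M : Mat n) → M ⊗ I ≡ M
  ⊗-identityʳ {n} M = coeff-ext λ i j i<n j<n → begin
    coeff (M ⊗ I) i j         ≡⟨ coeff-⊗-sparseColumn M I i<n j<n j<n (λ k k<n k≢j →
                                   trans (coeff-I k<n j<n) (δ-≢ k≢j)) ⟩
    coeff M i j * coeff I j j ≡⟨ cong (coeff M i j *_) (trans (coeff-I j<n j<n) (δ-refl j)) ⟩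
    coeff M i j * 1#          ≡⟨ *-identityʳ _ ⟩
    coeff M i j               ∎
    where open ≡-Reasoning

  ⊗-moveʳ : ∀ {n} {M N t t′ : Mat n} → t ⊗ t′ ≡ I → M ⊗ t ≡ N → M ≡ N ⊗ t′
  ⊗-moveʳ {M = M} {N} {t} {t′} tt′≡I Mt≡N = begin
    M            ≡⟨ ⊗-identityʳ M ⟨
    M ⊗ I        ≡⟨ cong (M ⊗_) tt′≡I ⟨
    M ⊗ (t ⊗ t′) ≡⟨ ⊗-assoc M t t′ ⟨
    (M ⊗ t) ⊗ t′ ≡⟨ cong (_⊗ t′) Mt≡N ⟩
    N ⊗ t′       ∎
    where open ≡-Reasoning

  ⊗-cancelʳ : ∀ {n} {M N t t′ : Mat n} → t ⊗ t′ ≡ I → M ⊗ t ≡ N ⊗ t → M ≡ N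
  ⊗-cancelʳ {M = M} {N} {t} {t′} tt′≡I Mt≡Nt = begin
    M            ≡⟨ ⊗-moveʳ {t = t} {t′} tt′≡I Mt≡Nt ⟩
    (N ⊗ t) ⊗ t′ ≡⟨ ⊗-assoc N t t′ ⟩
    N ⊗ (t ⊗ t′) ≡⟨ cong (N ⊗_) tt′≡I ⟩
    N ⊗ I        ≡⟨ ⊗-identityʳ N ⟩
    N            ∎
    where open ≡-Reasoning

  -- The identity with its diagonal 2 × 2 block at rows and columns k, k + 1 replaced by ((a, b), (c, d)).
  block : (a b c d : Carrier) → ℕ → ℕ → ℕ → Carrier
  block a b c d zero    0       0       = a
  block a b c d zero    0       1       = b
  block a b c d zero    1       0       = c
  block a b c d zero    1       1       = d
  block a b c d zero    i       j       = δ i j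
  block a b c d (suc k) zero    j       = δ zero j
  block a b c d (suc k) (suc i) zero    = 0#
  block a b c d (suc k) (suc i) (suc j) = block a b c d k i j

  Block : ∀ {n} (a b c d : Carrier) → ℕ → Mat n
  Block a b c d k = fromFun (block a b c d k)

  coeff-Block : ∀ {n} (a b c d : Carrier) k {i j} → i < n → j < n → coeff (Block {n} a b c d k) i j ≡ block a b c d k i j
  coeff-Block a b c d k = coeff-fromFun (block a b c d k)

  module _ (a b c d : Carrier) where

    block-topLeft : ∀ k → block a b c d k k k ≡ a
    block-topLeft zero    = refl
    block-topLeft (suc k) = block-topLeft k

    block-topRight : ∀ k → block a b c d k k (suc k) ≡ b
    block-topRight zero    = refl
    block-topRight (suc k) = block-topRight k

    block-bottomLeft : ∀ k → block a b c d k (suc k) k ≡ c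
    block-bottomLeft zero    = refl
    block-bottomLeft (suc k) = block-bottomLeft k

    block-bottomRight : ∀ k → block a b c d k (suc k) (suc k) ≡ d
    block-bottomRight zero    = refl
    block-bottomRight (suc k) = block-bottomRight k

    block-outsideRows : ∀ {k i} j → i ≢ k → i ≢ suc k → block a b c d k i j ≡ δ i j
    block-outsideRows {zero}  {zero}        j i≢0 _ = contradiction refl i≢0
    block-outsideRows {zero}  {suc zero}    j _ i≢1 = contradiction refl i≢1
    block-outsideRows {zero}  {suc (suc i)} j _ _   = refl
    block-outsideRows {suc k} {zero}        j _ _   = refl
    block-outsideRows {suc k} {suc i} zero    _ _   = refl
    block-outsideRows {suc k} {suc i} (suc j) i≢sk i≢ssk =
      block-outsideRows j (i≢sk ∘ cong suc) (i≢ssk ∘ cong suc)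

    block-outsideCols : ∀ {k j} i → j ≢ k → j ≢ suc k → block a b c d k i j ≡ δ i j
    block-outsideCols {zero}  {zero}        i j≢0 _ = contradiction refl j≢0
    block-outsideCols {zero}  {suc zero}    i _ j≢1 = contradiction refl j≢1
    block-outsideCols {zero}  {suc (suc j)} zero          _ _ = refl
    block-outsideCols {zero}  {suc (suc j)} (suc zero)    _ _ = refl
    block-outsideCols {zero}  {suc (suc j)} (suc (suc i)) _ _ = refl
    block-outsideCols {suc k} {j}     zero    _ _ = refl
    block-outsideCols {suc k} {zero}  (suc i) _ _ = refl
    block-outsideCols {suc k} {suc j} (suc i) j≢sk j≢ssk =
      block-outsideCols i (j≢sk ∘ cong suc) (j≢ssk ∘ cong suc)

  block-identity : ∀ k i j → block 1# 0# 0# 1# k i j ≡ δ i j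
  block-identity zero    zero          zero          = refl
  block-identity zero    zero          (suc zero)    = refl
  block-identity zero    zero          (suc (suc j)) = refl
  block-identity zero    (suc zero)    zero          = refl
  block-identity zero    (suc zero)    (suc zero)    = refl
  block-identity zero    (suc zero)    (suc (suc j)) = refl
  block-identity zero    (suc (suc i)) j             = refl
  block-identity (suc k) zero          j             = refl
  block-identity (suc k) (suc i)       zero          = refl
  block-identity (suc k) (suc i)       (suc j)       = block-identity k i j

  module _ {n} (a b c d : Carrier) {k} (sk<n : suc k < n) where
    private
      k<n : k < n
      k<n = ℕₚ.<-trans (ℕₚ.n<1+n k) sk<n

      X : Mat n
      X = Block a b c d k

      coeff-X : ∀ {i j} → i < n → j < n → coeff X i j ≡ block a b c d k i j
      coeff-X = coeff-Block a b c d k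

      X-outsideRows : ∀ {i j} → i < n → j < n → i ≢ k → i ≢ suc k → i ≢ j → coeff X i j ≡ 0#
      X-outsideRows i<n j<n i≢k i≢sk i≢j = trans (coeff-X i<n j<n) (trans (block-outsideRows a b c d _ i≢k i≢sk) (δ-≢ i≢j))

      top-row : ∀ x y → coeff X k k * x + coeff X k (suc k) * y ≡ a * x + b * y
      top-row x y = cong₂ (λ u v → u * x + v * y) (trans (coeff-X k<n k<n) (block-topLeft a b c d k))
                                                  (trans (coeff-X k<n sk<n) (block-topRight a b c d k))

      bottom-row : ∀ x y → coeff X (suc k) k * x + coeff X (suc k) (suc k) * y ≡ c * x + d * y
      bottom-row x y = cong₂ (λ u v → u * x + v * y) (trans (coeff-X sk<n k<n) (block-bottomLeft a b c d k))
                                                     (trans (coeff-X sk<n sk<n) (block-bottomRight a b c d k))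

      other-row : ∀ {i} → i < n → i ≢ k → i ≢ suc k → ∀ x y → coeff X i k * x + coeff X i (suc k) * y ≡ 0#
      other-row i<n i≢k i≢sk x y = begin
        coeff X _ k * x + coeff X _ (suc k) * y
          ≡⟨ cong₂ (λ u v → u * x + v * y) (X-outsideRows i<n k<n i≢k i≢sk i≢k)
                                           (X-outsideRows i<n sk<n i≢k i≢sk i≢sk) ⟩
        0# * x + 0# * y ≡⟨ cong₂ _+_ (zeroˡ x) (zeroˡ y) ⟩
        0# + 0#         ≡⟨ +-identityˡ 0# ⟩
        0#              ∎
        where open ≡-Reasoning

    Block-combination-left : ∀ {i} → i < n → ∀ x y q s →
                             coeff (Block a b c d k) i k * x + coeff (Block a b c d k) i (suc k) * y ≡
                             block (a * x + b * y) q (c * x + d * y) s k i k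
    Block-combination-left {i} i<n x y q s with i ℕ.≟ k | i ℕ.≟ suc k
    ... | yes refl | _        = trans (top-row x y) (sym (block-topLeft _ q _ s k))
    ... | no _     | yes refl = trans (bottom-row x y) (sym (block-bottomLeft _ q _ s k))
    ... | no i≢k   | no i≢sk  = trans (other-row i<n i≢k i≢sk x y)
                                      (sym (trans (block-outsideRows _ q _ s k i≢k i≢sk) (δ-≢ i≢k)))

    Block-combination-right : ∀ {i} → i < n → ∀ x y p r →
                              coeff (Block a b c d k) i k * x + coeff (Block a b c d k) i (suc k) * y ≡
                              block p (a * x + b * y) r (c * x + d * y) k i (suc k)
    Block-combination-right {i} i<n x y p r with i ℕ.≟ k | i ℕ.≟ suc k
    ... | yes refl | _        = trans (top-row x y) (sym (block-topRight p _ r _ k))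
    ... | no _     | yes refl = trans (bottom-row x y) (sym (block-bottomRight p _ r _ k))
    ... | no i≢k   | no i≢sk  = trans (other-row i<n i≢k i≢sk x y)
                                      (sym (trans (block-outsideRows p _ r _ (suc k) i≢k i≢sk) (δ-≢ i≢sk)))

    coeff-⊗-Block-left : ∀ (Y : Mat n) {i} → i < n →
                         coeff (Y ⊗ Block a b c d k) i k ≡ coeff Y i k * a + coeff Y i (suc k) * c
    coeff-⊗-Block-left Y i<n =
      trans (coeff-⊗-pairColumn Y X i<n k<n sk<n λ m m<n m≢k m≢sk → X-outsideRows m<n k<n m≢k m≢sk m≢k)
            (cong₂ _+_ (cong (_ *_) (trans (coeff-X k<n k<n) (block-topLeft a b c d k)))
                       (cong (_ *_) (trans (coeff-X sk<n k<n) (block-bottomLeft a b c d k))))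

    coeff-⊗-Block-right : ∀ (Y : Mat n) {i} → i < n →
                          coeff (Y ⊗ Block a b c d k) i (suc k) ≡ coeff Y i k * b + coeff Y i (suc k) * d
    coeff-⊗-Block-right Y i<n =
      trans (coeff-⊗-pairColumn Y X i<n sk<n sk<n λ m m<n m≢k m≢sk → X-outsideRows m<n sk<n m≢k m≢sk m≢sk)
            (cong₂ _+_ (cong (_ *_) (trans (coeff-X k<n sk<n) (block-topRight a b c d k)))
                       (cong (_ *_) (trans (coeff-X sk<n sk<n) (block-bottomRight a b c d k))))

    coeff-⊗-Block-outside : ∀ (Y : Mat n) {i j} → i < n → j < n → j ≢ k → j ≢ suc k →
                            coeff (Y ⊗ Block a b c d k) i j ≡ coeff Y i j
    coeff-⊗-Block-outside Y {i} {j} i<n j<n j≢k j≢sk = begin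
      coeff (Y ⊗ X) i j   ≡⟨ coeff-⊗-sparseColumn Y X i<n j<n j<n (λ m m<n m≢j → trans (X-column m<n) (δ-≢ m≢j)) ⟩
      coeff Y i j * coeff X j j ≡⟨ cong (coeff Y i j *_) (trans (X-column j<n) (δ-refl j)) ⟩
      coeff Y i j * 1#    ≡⟨ *-identityʳ _ ⟩
      coeff Y i j         ∎
      where
      open ≡-Reasoning
      X-column : ∀ {m} → m < n → coeff X m j ≡ δ m j
      X-column m<n = trans (coeff-X m<n j<n) (block-outsideCols a b c d _ j≢k j≢sk)

  Block-⊗-Block : ∀ {n} (a b c d a′ b′ c′ d′ : Carrier) {k} → suc k < n →
                  Block {n} a b c d k ⊗ Block a′ b′ c′ d′ k ≡
                  Block (a * a′ + b * c′) (a * b′ + b * d′) (c * a′ + d * c′) (c * b′ + d * d′) k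
  Block-⊗-Block {n} a b c d a′ b′ c′ d′ {k} sk<n = coeff-ext λ i j i<n j<n →
    trans (product i<n j<n) (sym (coeff-Block _ _ _ _ k i<n j<n))
    where
    open ≡-Reasoning
    z : ℕ → ℕ → Carrier
    z = block (a * a′ + b * c′) (a * b′ + b * d′) (c * a′ + d * c′) (c * b′ + d * d′) k
    product : ∀ {i j} → i < n → j < n → coeff (Block a b c d k ⊗ Block a′ b′ c′ d′ k) i j ≡ z i j
    product {i} {j} i<n j<n with j ℕ.≟ k | j ℕ.≟ suc k
    ... | yes refl | _        = trans (coeff-⊗-Block-left a′ b′ c′ d′ sk<n _ i<n)
                                      (Block-combination-left a b c d sk<n i<n a′ c′ _ _)
    ... | no _     | yes refl = trans (coeff-⊗-Block-right a′ b′ c′ d′ sk<n _ i<n)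
                                      (Block-combination-right a b c d sk<n i<n b′ d′ _ _)
    ... | no j≢k   | no j≢sk  = begin
      coeff (Block a b c d k ⊗ Block a′ b′ c′ d′ k) i j
        ≡⟨ coeff-⊗-Block-outside a′ b′ c′ d′ sk<n _ i<n j<n j≢k j≢sk ⟩
      coeff (Block a b c d k) i j                       ≡⟨ coeff-Block a b c d k i<n j<n ⟩
      block a b c d k i j                               ≡⟨ block-outsideCols a b c d i j≢k j≢sk ⟩
      δ i j                                             ≡⟨ block-outsideCols _ _ _ _ i j≢k j≢sk ⟨
      z i j                                             ∎

  fromFun-cong : ∀ {n} {f g : ℕ → ℕ → Carrier} → (∀ i j → f i j ≡ g i j) → fromFun {n} f ≡ fromFun g
  fromFun-cong f≗g = Vecₚ.tabulate-cong λ i → Vecₚ.tabulate-cong λ j → f≗g (toℕ i) (toℕ j)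

  Block-inverse : ∀ {n} {a b c d a′ b′ c′ d′ : Carrier} {k} → suc k < n →
                  a * a′ + b * c′ ≡ 1# → a * b′ + b * d′ ≡ 0# →
                  c * a′ + d * c′ ≡ 0# → c * b′ + d * d′ ≡ 1# →
                  Block {n} a b c d k ⊗ Block a′ b′ c′ d′ k ≡ I
  Block-inverse {n} {a} {b} {c} {d} {a′} {b′} {c′} {d′} {k} sk<n e₁₁ e₁₂ e₂₁ e₂₂ = begin
    Block a b c d k ⊗ Block a′ b′ c′ d′ k
      ≡⟨ Block-⊗-Block a b c d a′ b′ c′ d′ sk<n ⟩
    Block (a * a′ + b * c′) (a * b′ + b * d′) (c * a′ + d * c′) (c * b′ + d * d′) k
      ≡⟨ cong₂ (λ p q → Block p q (c * a′ + d * c′) (c * b′ + d * d′) k) e₁₁ e₁₂ ⟩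
    Block 1# 0# (c * a′ + d * c′) (c * b′ + d * d′) k
      ≡⟨ cong₂ (λ r s → Block 1# 0# r s k) e₂₁ e₂₂ ⟩
    Block 1# 0# 0# 1# k
      ≡⟨ fromFun-cong (block-identity k) ⟩
    I ∎
    where open ≡-Reasoning

  punchInℕ : ℕ → ℕ → ℕ
  punchInℕ zero    c       = suc c
  punchInℕ (suc j) zero    = zero
  punchInℕ (suc j) (suc c) = suc (punchInℕ j c)

  toℕ-punchIn : ∀ {n} (j : Fin (suc n)) (k : Fin n) → toℕ (Fin.punchIn j k) ≡ punchInℕ (toℕ j) (toℕ k)
  toℕ-punchIn Fin.zero    k           = refl
  toℕ-punchIn (Fin.suc j) Fin.zero    = refl
  toℕ-punchIn (Fin.suc j) (Fin.suc k) = cong suc (toℕ-punchIn j k)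

  punchInℕ-< : ∀ {m} j c → j < suc m → c < m → punchInℕ j c < suc m
  punchInℕ-< zero    c       _         c<m       = s≤s c<m
  punchInℕ-< (suc j) zero    _         (s≤s _)   = s≤s z≤n
  punchInℕ-< (suc j) (suc c) (s≤s j<m) (s≤s c<m) = s≤s (punchInℕ-< j c j<m c<m)

  punchInℕ-injective : ∀ j {a b} → punchInℕ j a ≡ punchInℕ j b → a ≡ b
  punchInℕ-injective zero    refl = refl
  punchInℕ-injective (suc j) {zero}  {zero}  _  = refl
  punchInℕ-injective (suc j) {suc a} {suc b} eq = cong suc (punchInℕ-injective j (ℕₚ.suc-injective eq))

  punchInℕ-≢ : ∀ j c → punchInℕ j c ≢ j
  punchInℕ-≢ zero    c       ()
  punchInℕ-≢ (suc j) zero    ()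
  punchInℕ-≢ (suc j) (suc c) eq = punchInℕ-≢ j c (ℕₚ.suc-injective eq)

  punchInℕ-diag : ∀ a → punchInℕ a a ≡ suc a
  punchInℕ-diag zero    = refl
  punchInℕ-diag (suc a) = cong suc (punchInℕ-diag a)

  punchInℕ-suc-diag : ∀ a → punchInℕ (suc a) a ≡ a
  punchInℕ-suc-diag zero    = refl
  punchInℕ-suc-diag (suc a) = cong suc (punchInℕ-suc-diag a)

  punchInℕ-suc : ∀ {a c} → c ≢ a → punchInℕ (suc a) c ≡ punchInℕ a c
  punchInℕ-suc {zero}  {zero}  c≢a = contradiction refl c≢a
  punchInℕ-suc {zero}  {suc c} _   = refl
  punchInℕ-suc {suc a} {zero}  _   = refl
  punchInℕ-suc {suc a} {suc c} c≢a = cong suc (punchInℕ-suc (c≢a ∘ cong suc))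

  punchInℕ-onto : ∀ {m j c₀} → j < suc m → c₀ < suc m → j ≢ c₀ → ∃[ c ] (c < m × punchInℕ j c ≡ c₀)
  punchInℕ-onto {j = zero}  {zero}  _ _ 0≢0 = contradiction refl 0≢0
  punchInℕ-onto {j = zero}  {suc c} _ (s≤s c<m) _ = c , c<m , refl
  punchInℕ-onto {zero}  {suc j} (s≤s ()) _ _
  punchInℕ-onto {suc m} {suc j} {zero}  _ _ _ = zero , s≤s z≤n , refl
  punchInℕ-onto {suc m} {suc j} {suc c} (s≤s j<m) (s≤s c<m) j≢c
    with c′ , c′<m , eq ← punchInℕ-onto j<m c<m (j≢c ∘ cong suc)
    = suc c′ , s≤s c′<m , cong suc eq

  punchInℕ-onto-adjacent : ∀ {m j a} → j < suc m → suc a < suc m → j ≢ a → j ≢ suc a →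
                           ∃[ a′ ] (suc a′ < m × punchInℕ j a′ ≡ a × punchInℕ j (suc a′) ≡ suc a)
  punchInℕ-onto-adjacent {j = zero} {zero}  _ _ 0≢0 _ = contradiction refl 0≢0
  punchInℕ-onto-adjacent {j = zero} {suc a} _ (s≤s sa<m) _ _ = a , sa<m , refl , refl
  punchInℕ-onto-adjacent {zero} {suc j} (s≤s ()) _ _ _
  punchInℕ-onto-adjacent {suc m} {suc zero} {zero} _ _ _ 1≢1 = contradiction refl 1≢1
  punchInℕ-onto-adjacent {suc m} {suc (suc j)} {zero} (s≤s (s≤s j<m)) _ _ _ =
    zero , s≤s (ℕₚ.≤-<-trans z≤n j<m) , refl , refl
  punchInℕ-onto-adjacent {suc m} {suc j} {suc a} (s≤s j<m) (s≤s sa<m) j≢a j≢sa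
    with a′ , sa′<m , eq₁ , eq₂ ← punchInℕ-onto-adjacent j<m sa<m (j≢a ∘ cong suc) (j≢sa ∘ cong suc)
    = suc a′ , s≤s sa′<m , cong suc eq₁ , cong suc eq₂

  *-linear : ∀ u a b x y → u * (a * x + b * y) ≡ a * (u * x) + b * (u * y)
  *-linear u a b x y = trans (distribˡ u _ _) (cong₂ _+_ (x∙yz≈y∙xz u a x) (x∙yz≈y∙xz u b y))

  *-linear-middle : ∀ s a b x y z → s * (a * x + b * y) * z ≡ a * (s * x * z) + b * (s * y * z)
  *-linear-middle s a b x y z = begin
    s * (a * x + b * y) * z             ≡⟨ cong (_* z) (*-linear s a b x y) ⟩
    (a * (s * x) + b * (s * y)) * z     ≡⟨ distribʳ z _ _ ⟩
    a * (s * x) * z + b * (s * y) * z   ≡⟨ cong₂ _+_ (*-assoc a _ z) (*-assoc b _ z) ⟩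
    a * (s * x * z) + b * (s * y * z)   ∎
    where open ≡-Reasoning

  minor : (ℕ → ℕ → Carrier) → ℕ → ℕ → ℕ → Carrier
  minor f j r c = f (suc r) (punchInℕ j c)

  detℕ : ℕ → (ℕ → ℕ → Carrier) → Carrier
  detℕ zero    f = 1#
  detℕ (suc n) f = ∑ (suc n) (λ j → sgn j * f 0 j * detℕ n (minor f j))

  laplaceTerm : ℕ → (ℕ → ℕ → Carrier) → ℕ → Carrier
  laplaceTerm n f j = sgn j * f 0 j * detℕ n (minor f j)

  detℕ-cong : ∀ n {f g : ℕ → ℕ → Carrier} → (∀ r c → r < n → c < n → f r c ≡ g r c) → detℕ n f ≡ detℕ n g
  detℕ-cong zero    _   = refl
  detℕ-cong (suc n) f≗g = ∑-cong (suc n) λ j j<n →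
    cong₂ (λ x y → sgn j * x * y) (f≗g 0 j (s≤s z≤n) j<n)
          (detℕ-cong n λ r c r<n c<n → f≗g (suc r) (punchInℕ j c) (s≤s r<n) (punchInℕ-< j c j<n c<n))

  lookup-removeAt : ∀ {A : Set} {n} (xs : Vec A (suc n)) j k → lookup (removeAt xs j) k ≡ lookup xs (Fin.punchIn j k)
  lookup-removeAt (x ∷ xs)     Fin.zero    k           = refl
  lookup-removeAt (x ∷ y ∷ xs) (Fin.suc j) Fin.zero    = refl
  lookup-removeAt (x ∷ y ∷ xs) (Fin.suc j) (Fin.suc k) = lookup-removeAt (y ∷ xs) j k

  det≡detℕ : ∀ {n} (M : Mat n) → det M ≡ detℕ n (coeff M)
  det≡detℕ {zero}  []       = refl
  det≡detℕ {suc n} (r ∷ rs) = sumFin≡∑ (suc n) λ k →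
    cong₂ _*_ (cong (sgn (toℕ k) *_) (sym (coeff-toℕ (r ∷ rs) Fin.zero k)))
              (trans (det≡detℕ (map (λ row → removeAt row k) rs)) (detℕ-cong n (minor-coeff k)))
    where
    minor-coeff : ∀ k a b → a < n → b < n →
                  coeff (map (λ row → removeAt row k) rs) a b ≡ minor (coeff (r ∷ rs)) (toℕ k) a b
    minor-coeff k a b a<n b<n = begin
      coeff (map (λ row → removeAt row k) rs) a b
        ≡⟨ coeff-< _ a<n b<n ⟩
      lookup (lookup (map (λ row → removeAt row k) rs) (fromℕ< a<n)) (fromℕ< b<n)
        ≡⟨ cong (λ row → lookup row (fromℕ< b<n)) (Vecₚ.lookup-map (fromℕ< a<n) _ rs) ⟩
      lookup (removeAt (lookup rs (fromℕ< a<n)) k) (fromℕ< b<n)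
        ≡⟨ lookup-removeAt (lookup rs (fromℕ< a<n)) k (fromℕ< b<n) ⟩
      entry (r ∷ rs) (Fin.suc (fromℕ< a<n)) (Fin.punchIn k (fromℕ< b<n))
        ≡⟨ coeff-toℕ (r ∷ rs) _ _ ⟨
      coeff (r ∷ rs) (suc (toℕ (fromℕ< a<n))) (toℕ (Fin.punchIn k (fromℕ< b<n)))
        ≡⟨ cong₂ (coeff (r ∷ rs)) (cong suc (Finₚ.toℕ-fromℕ< a<n))
                 (trans (toℕ-punchIn k _) (cong (punchInℕ (toℕ k)) (Finₚ.toℕ-fromℕ< b<n))) ⟩
      coeff (r ∷ rs) (suc a) (punchInℕ (toℕ k) b) ∎
      where open ≡-Reasoning

  detℕ-linear-column : ∀ n {f g h : ℕ → ℕ → Carrier} {c₀} (a b : Carrier) → c₀ < n →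
                       (∀ r → r < n → h r c₀ ≡ a * f r c₀ + b * g r c₀) →
                       (∀ r c → r < n → c < n → c ≢ c₀ → h r c ≡ f r c) →
                       (∀ r c → r < n → c < n → c ≢ c₀ → g r c ≡ f r c) →
                       detℕ n h ≡ a * detℕ n f + b * detℕ n g
  detℕ-linear-column (suc m) {f} {g} {h} {c₀} a b c₀<n h-col h-off g-off = begin
    ∑ (suc m) (laplaceTerm m h)
      ≡⟨ ∑-cong (suc m) term ⟩
    ∑ (suc m) (λ j → a * laplaceTerm m f j + b * laplaceTerm m g j)
      ≡⟨ ∑-+ (suc m) _ _ ⟩
    ∑ (suc m) (λ j → a * laplaceTerm m f j) + ∑ (suc m) (λ j → b * laplaceTerm m g j)
      ≡⟨ cong₂ _+_ (*-distribˡ-∑ (suc m) a) (*-distribˡ-∑ (suc m) b) ⟨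
    a * detℕ (suc m) f + b * detℕ (suc m) g ∎
    where
    open ≡-Reasoning
    term : ∀ j → j < suc m → laplaceTerm m h j ≡ a * laplaceTerm m f j + b * laplaceTerm m g j
    term j j<n with j ℕ.≟ c₀
    ... | yes refl = begin
      sgn j * h 0 j * detℕ m (minor h j)
        ≡⟨ cong₂ (λ x y → sgn j * x * y) (h-col 0 (s≤s z≤n)) (same-minor h-off) ⟩
      sgn j * (a * f 0 j + b * g 0 j) * detℕ m (minor f j)
        ≡⟨ *-linear-middle (sgn j) a b (f 0 j) (g 0 j) _ ⟩
      a * laplaceTerm m f j + b * (sgn j * g 0 j * detℕ m (minor f j))
        ≡⟨ cong (λ y → a * laplaceTerm m f j + b * (sgn j * g 0 j * y)) (same-minor g-off) ⟨
      a * laplaceTerm m f j + b * laplaceTerm m g j ∎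
      where
      same-minor : ∀ {k} → (∀ r c → r < suc m → c < suc m → c ≢ j → k r c ≡ f r c) →
                   detℕ m (minor k j) ≡ detℕ m (minor f j)
      same-minor k-off = detℕ-cong m λ r c r<m c<m →
        k-off (suc r) (punchInℕ j c) (s≤s r<m) (punchInℕ-< j c j<n c<m) (punchInℕ-≢ j c)
    ... | no j≢c₀ with c₀′ , c₀′<m , j↑c₀′≡c₀ ← punchInℕ-onto j<n c₀<n j≢c₀ = begin
      sgn j * h 0 j * detℕ m (minor h j)
        ≡⟨ cong₂ (λ x y → sgn j * x * y) (h-off 0 j (s≤s z≤n) j<n j≢c₀) minor-linear ⟩
      sgn j * f 0 j * (a * detℕ m (minor f j) + b * detℕ m (minor g j))
        ≡⟨ *-linear (sgn j * f 0 j) a b _ _ ⟩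
      a * laplaceTerm m f j + b * (sgn j * f 0 j * detℕ m (minor g j))
        ≡⟨ cong (λ x → a * laplaceTerm m f j + b * (sgn j * x * detℕ m (minor g j))) (g-off 0 j (s≤s z≤n) j<n j≢c₀) ⟨
      a * laplaceTerm m f j + b * laplaceTerm m g j ∎
      where
      off : ∀ {k} → (∀ r c → r < suc m → c < suc m → c ≢ c₀ → k r c ≡ f r c) →
            ∀ r c → r < m → c < m → c ≢ c₀′ → minor k j r c ≡ minor f j r c
      off k-off r c r<m c<m c≢c₀′ = k-off (suc r) (punchInℕ j c) (s≤s r<m) (punchInℕ-< j c j<n c<m)
                                          (c≢c₀′ ∘ punchInℕ-injective j ∘ flip trans (sym j↑c₀′≡c₀))
      minor-linear : detℕ m (minor h j) ≡ a * detℕ m (minor f j) + b * detℕ m (minor g j)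
      minor-linear = detℕ-linear-column m a b c₀′<m
        (λ r r<m → subst (λ c → h (suc r) c ≡ a * f (suc r) c + b * g (suc r) c) (sym j↑c₀′≡c₀)
                         (h-col (suc r) (s≤s r<m)))
        (off h-off) (off g-off)

  detℕ-scale-column : ∀ n {f h : ℕ → ℕ → Carrier} {c₀} (a : Carrier) → c₀ < n →
                      (∀ r → r < n → h r c₀ ≡ a * f r c₀) →
                      (∀ r c → r < n → c < n → c ≢ c₀ → h r c ≡ f r c) →
                      detℕ n h ≡ a * detℕ n f
  detℕ-scale-column n {f} a c₀<n h-col h-off = begin
    detℕ n _                          ≡⟨ detℕ-linear-column n a 0# c₀<n
                                           (λ r r<n → trans (h-col r r<n) (sym (drop-zero _ _))) h-off (λ _ _ _ _ _ → refl) ⟩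
    a * detℕ n f + 0# * detℕ n f      ≡⟨ drop-zero _ _ ⟩
    a * detℕ n f                      ∎
    where
    open ≡-Reasoning
    drop-zero : ∀ x y → x + 0# * y ≡ x
    drop-zero x y = trans (cong (x +_) (zeroˡ y)) (+-identityʳ x)

  detℕ-zero-column : ∀ n {f : ℕ → ℕ → Carrier} {c₀} → c₀ < n → (∀ r → r < n → f r c₀ ≡ 0#) →
                     detℕ n f ≡ 0#
  detℕ-zero-column n {f} c₀<n f-col =
    trans (detℕ-scale-column n 0# c₀<n (λ r r<n → trans (f-col r r<n) (sym (zeroˡ _))) (λ _ _ _ _ _ → refl))
          (zeroˡ _)

  adjacent-cofactors : ∀ σ x y a b t →
                       σ * x * (1# * a + t * b) + (- σ) * (y + t * x) * b ≡ σ * x * a + (- σ) * y * b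
  adjacent-cofactors σ x y a b t = begin
    σ * x * (1# * a + t * b) + (- σ) * (y + t * x) * b
      ≡⟨ cong₂ _+_ (trans (distribˡ (σ * x) _ _) (cong (λ z → σ * x * z + σ * x * (t * b)) (*-identityˡ a)))
                   (trans (cong (_* b) (distribˡ (- σ) y (t * x))) (distribʳ b _ _)) ⟩
    (σ * x * a + σ * x * (t * b)) + ((- σ) * y * b + (- σ) * (t * x) * b)
      ≡⟨ interchange _ _ _ _ ⟩
    (σ * x * a + (- σ) * y * b) + (σ * x * (t * b) + (- σ) * (t * x) * b)
      ≡⟨ cong (σ * x * a + (- σ) * y * b +_) (trans (cong₂ _+_ regroup negate) (-‿inverseʳ _)) ⟩
    (σ * x * a + (- σ) * y * b) + 0#
      ≡⟨ +-identityʳ _ ⟩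
    σ * x * a + (- σ) * y * b ∎
    where
    open ≡-Reasoning
    regroup : σ * x * (t * b) ≡ σ * (t * x) * b
    regroup = trans (*-assoc σ x (t * b))
                    (trans (cong (σ *_) (trans (sym (*-assoc x t b)) (cong (_* b) (*-comm x t))))
                           (sym (*-assoc σ (t * x) b)))
    negate : (- σ) * (t * x) * b ≡ - (σ * (t * x) * b)
    negate = trans (cong (_* b) (sym (-‿distribˡ-* σ (t * x)))) (sym (-‿distribˡ-* (σ * (t * x)) b))

  detℕ-add-column : ∀ n {f h : ℕ → ℕ → Carrier} {a} (t : Carrier) → suc a < n →
                    (∀ r → r < n → h r (suc a) ≡ f r (suc a) + t * f r a) →
                    (∀ r c → r < n → c < n → c ≢ suc a → h r c ≡ f r c) →
                    detℕ n h ≡ detℕ n f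
  detℕ-add-column (suc m) {f} {h} {a} t sa<n h-col h-off = ∑-cong-pair (suc m) sa<n others pair
    where
    open ≡-Reasoning
    a<n : a < suc m
    a<n = ℕₚ.<-trans (ℕₚ.n<1+n a) sa<n

    others : ∀ j → j < suc m → j ≢ a → j ≢ suc a → laplaceTerm m h j ≡ laplaceTerm m f j
    others j j<n j≢a j≢sa with a′ , sa′<m , j↑a′≡a , j↑sa′≡sa ← punchInℕ-onto-adjacent j<n sa<n j≢a j≢sa =
      cong₂ (λ x y → sgn j * x * y) (h-off 0 j (s≤s z≤n) j<n j≢sa) (detℕ-add-column m t sa′<m minor-col minor-off)
      where
      minor-col : ∀ r → r < m → minor h j r (suc a′) ≡ minor f j r (suc a′) + t * minor f j r a′
      minor-col r r<m = begin
        h (suc r) (punchInℕ j (suc a′))     ≡⟨ cong (h (suc r)) j↑sa′≡sa ⟩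
        h (suc r) (suc a)                   ≡⟨ h-col (suc r) (s≤s r<m) ⟩
        f (suc r) (suc a) + t * f (suc r) a ≡⟨ cong₂ (λ c c′ → f (suc r) c + t * f (suc r) c′) j↑sa′≡sa j↑a′≡a ⟨
        minor f j r (suc a′) + t * minor f j r a′ ∎
      minor-off : ∀ r c → r < m → c < m → c ≢ suc a′ → minor h j r c ≡ minor f j r c
      minor-off r c r<m c<m c≢sa′ = h-off (suc r) (punchInℕ j c) (s≤s r<m) (punchInℕ-< j c j<n c<m)
                                          (c≢sa′ ∘ punchInℕ-injective j ∘ flip trans (sym j↑sa′≡sa))

    minor-a : detℕ m (minor h a) ≡ 1# * detℕ m (minor f a) + t * detℕ m (minor f (suc a))
    minor-a = detℕ-linear-column m 1# t (ℕ.s<s⁻¹ sa<n)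
      (λ r r<m → begin
        h (suc r) (punchInℕ a a)            ≡⟨ cong (h (suc r)) (punchInℕ-diag a) ⟩
        h (suc r) (suc a)                   ≡⟨ h-col (suc r) (s≤s r<m) ⟩
        f (suc r) (suc a) + t * f (suc r) a ≡⟨ cong₂ _+_ (trans (sym (*-identityˡ _))
                                                                (cong (λ c → 1# * f (suc r) c) (sym (punchInℕ-diag a))))
                                                         (cong (λ c → t * f (suc r) c) (sym (punchInℕ-suc-diag a))) ⟩
        1# * minor f a r a + t * minor f (suc a) r a ∎)
      (λ r c r<m c<m c≢a → h-off (suc r) (punchInℕ a c) (s≤s r<m) (punchInℕ-< a c a<n c<m)
                                 (c≢a ∘ punchInℕ-injective a ∘ flip trans (sym (punchInℕ-diag a))))
      (λ r c r<m c<m c≢a → cong (f (suc r)) (punchInℕ-suc c≢a))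

    minor-sa : detℕ m (minor h (suc a)) ≡ detℕ m (minor f (suc a))
    minor-sa = detℕ-cong m λ r c r<m c<m →
      h-off (suc r) (punchInℕ (suc a) c) (s≤s r<m) (punchInℕ-< (suc a) c sa<n c<m) (punchInℕ-≢ (suc a) c)

    pair : laplaceTerm m h a + laplaceTerm m h (suc a) ≡ laplaceTerm m f a + laplaceTerm m f (suc a)
    pair = trans (cong₂ _+_ (cong₂ (λ x y → sgn a * x * y) (h-off 0 a (s≤s z≤n) a<n (λ ())) minor-a)
                            (cong₂ (λ x y → sgn (suc a) * x * y) (h-col 0 (s≤s z≤n)) minor-sa))
                 (adjacent-cofactors (sgn a) (f 0 a) (f 0 (suc a)) _ _ t)

  x+y*0≡x : ∀ x y → x + y * 0# ≡ x
  x+y*0≡x x y = trans (cong (x +_) (zeroʳ y)) (+-identityʳ x)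

  x*0+y≡y : ∀ x y → x * 0# + y ≡ y
  x*0+y≡y x y = trans (cong (_+ y) (zeroʳ x)) (+-identityˡ y)

  det-zero-column : ∀ {n} (D : Mat n) {c₀} → c₀ < n → (∀ r → r < n → coeff D r c₀ ≡ 0#) → det D ≡ 0#
  det-zero-column {n} D c₀<n D-col = trans (det≡detℕ D) (detℕ-zero-column n c₀<n D-col)

  module _ {n} (D : Mat n) {k} (sk<n : suc k < n) where

    det-⊗-shear : ∀ b → det (D ⊗ Block 1# b 0# 1# k) ≡ det D
    det-⊗-shear b = begin
      det (D ⊗ Block 1# b 0# 1# k)            ≡⟨ det≡detℕ (D ⊗ Block 1# b 0# 1# k) ⟩
      detℕ n (coeff (D ⊗ Block 1# b 0# 1# k)) ≡⟨ detℕ-add-column n b sk<n column-sk other-columns ⟩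
      detℕ n (coeff D)                        ≡⟨ det≡detℕ D ⟨
      det D                                   ∎
      where
      open ≡-Reasoning
      column-sk : ∀ r → r < n → coeff (D ⊗ Block 1# b 0# 1# k) r (suc k) ≡ coeff D r (suc k) + b * coeff D r k
      column-sk r r<n = trans (coeff-⊗-Block-right 1# b 0# 1# sk<n D r<n)
                              (trans (cong₂ _+_ (*-comm _ b) (*-identityʳ _)) (+-comm _ _))
      other-columns : ∀ r c → r < n → c < n → c ≢ suc k → coeff (D ⊗ Block 1# b 0# 1# k) r c ≡ coeff D r c
      other-columns r c r<n c<n c≢sk with c ℕ.≟ k
      ... | yes refl = trans (coeff-⊗-Block-left 1# b 0# 1# sk<n D r<n) (trans (x+y*0≡x _ _) (*-identityʳ _))
      ... | no c≢k   = coeff-⊗-Block-outside 1# b 0# 1# sk<n D r<n c<n c≢k c≢sk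

    det-⊗-diagonal : ∀ u v → det (D ⊗ Block u 0# 0# v k) ≡ u * (v * det D)
    det-⊗-diagonal u v = begin
      det (D ⊗ Block u 0# 0# v k)            ≡⟨ det≡detℕ (D ⊗ Block u 0# 0# v k) ⟩
      detℕ n (coeff (D ⊗ Block u 0# 0# v k)) ≡⟨ detℕ-scale-column n u k<n scale-k keep-others-k ⟩
      u * detℕ n (coeff (D ⊗ Block 1# 0# 0# v k)) ≡⟨ cong (u *_) (detℕ-scale-column n v sk<n scale-sk keep-others-sk) ⟩
      u * (v * detℕ n (coeff D))             ≡⟨ cong (λ x → u * (v * x)) (det≡detℕ D) ⟨
      u * (v * det D)                        ∎
      where
      open ≡-Reasoning
      k<n : k < n
      k<n = ℕₚ.<-trans (ℕₚ.n<1+n k) sk<n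
      column-k : ∀ w {r} → r < n → coeff (D ⊗ Block w 0# 0# v k) r k ≡ w * coeff D r k
      column-k w r<n = trans (coeff-⊗-Block-left w 0# 0# v sk<n D r<n) (trans (x+y*0≡x _ _) (*-comm _ w))
      column-sk : ∀ w {r} → r < n → coeff (D ⊗ Block w 0# 0# v k) r (suc k) ≡ v * coeff D r (suc k)
      column-sk w r<n = trans (coeff-⊗-Block-right w 0# 0# v sk<n D r<n) (trans (x*0+y≡y _ _) (*-comm _ v))
      scale-k : ∀ r → r < n → coeff (D ⊗ Block u 0# 0# v k) r k ≡ u * coeff (D ⊗ Block 1# 0# 0# v k) r k
      scale-k r r<n = trans (column-k u r<n) (cong (u *_) (trans (sym (*-identityˡ _)) (sym (column-k 1# r<n))))
      keep-others-k : ∀ r c → r < n → c < n → c ≢ k →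
                      coeff (D ⊗ Block u 0# 0# v k) r c ≡ coeff (D ⊗ Block 1# 0# 0# v k) r c
      keep-others-k r c r<n c<n c≢k with c ℕ.≟ suc k
      ... | yes refl = trans (column-sk u r<n) (sym (column-sk 1# r<n))
      ... | no c≢sk  = trans (coeff-⊗-Block-outside u 0# 0# v sk<n D r<n c<n c≢k c≢sk)
                             (sym (coeff-⊗-Block-outside 1# 0# 0# v sk<n D r<n c<n c≢k c≢sk))
      scale-sk : ∀ r → r < n → coeff (D ⊗ Block 1# 0# 0# v k) r (suc k) ≡ v * coeff D r (suc k)
      scale-sk r r<n = column-sk 1# r<n
      keep-others-sk : ∀ r c → r < n → c < n → c ≢ suc k → coeff (D ⊗ Block 1# 0# 0# v k) r c ≡ coeff D r c
      keep-others-sk r c r<n c<n c≢sk with c ℕ.≟ k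
      ... | yes refl = trans (column-k 1# r<n) (*-identityˡ _)
      ... | no c≢k   = coeff-⊗-Block-outside 1# 0# 0# v sk<n D r<n c<n c≢k c≢sk

  lookup-∷ʳ-< : ∀ {A : Set} {n} (xs : Vec A n) x {i} (i<sn : i < suc n) (i<n : i < n) →
                lookup (xs ∷ʳ x) (fromℕ< i<sn) ≡ lookup xs (fromℕ< i<n)
  lookup-∷ʳ-< (y ∷ ys) x {zero}  _    _    = refl
  lookup-∷ʳ-< (y ∷ ys) x {suc i} i<sn i<n = lookup-∷ʳ-< ys x (ℕ.s<s⁻¹ i<sn) (ℕ.s<s⁻¹ i<n)

  lookup-∷ʳ-last : ∀ {A : Set} {n} (xs : Vec A n) x (n<sn : n < suc n) → lookup (xs ∷ʳ x) (fromℕ< n<sn) ≡ x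
  lookup-∷ʳ-last []       x _    = refl
  lookup-∷ʳ-last (y ∷ ys) x n<sn = lookup-∷ʳ-last ys x (ℕ.s<s⁻¹ n<sn)

  module _ {l} (D : Mat l) where
    private
      l<sl : l < suc l
      l<sl = ℕₚ.n<1+n l
      row-< : ∀ {r} (r<sl : r < suc l) (r<l : r < l) → lookup (embed D) (fromℕ< r<sl) ≡ lookup D (fromℕ< r<l) ∷ʳ 0#
      row-< r<sl r<l = trans (lookup-∷ʳ-< (map (_∷ʳ 0#) D) _ r<sl r<l) (Vecₚ.lookup-map (fromℕ< r<l) (_∷ʳ 0#) D)
      row-last : lookup (embed D) (fromℕ< l<sl) ≡ replicate l 0# ∷ʳ 1#
      row-last = lookup-∷ʳ-last (map (_∷ʳ 0#) D) _ l<sl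

    coeff-embed-inner : ∀ {r c} → r < l → c < l → coeff (embed D) r c ≡ coeff D r c
    coeff-embed-inner {r} {c} r<l c<l = begin
      coeff (embed D) r c                                  ≡⟨ coeff-< (embed D) r<sl c<sl ⟩
      lookup (lookup (embed D) (fromℕ< r<sl)) (fromℕ< c<sl) ≡⟨ cong (λ row → lookup row (fromℕ< c<sl)) (row-< r<sl r<l) ⟩
      lookup (lookup D (fromℕ< r<l) ∷ʳ 0#) (fromℕ< c<sl)    ≡⟨ lookup-∷ʳ-< (lookup D (fromℕ< r<l)) 0# c<sl c<l ⟩
      entry D (fromℕ< r<l) (fromℕ< c<l)                     ≡⟨ coeff-< D r<l c<l ⟨
      coeff D r c                                          ∎
      where
      open ≡-Reasoning
      r<sl = ℕₚ.m<n⇒m<1+n r<l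
      c<sl = ℕₚ.m<n⇒m<1+n c<l

    coeff-embed-lastColumn : ∀ {r} → r < l → coeff (embed D) r l ≡ 0#
    coeff-embed-lastColumn r<l = trans (coeff-< (embed D) (ℕₚ.m<n⇒m<1+n r<l) l<sl)
      (trans (cong (λ row → lookup row (fromℕ< l<sl)) (row-< (ℕₚ.m<n⇒m<1+n r<l) r<l))
             (lookup-∷ʳ-last (lookup D (fromℕ< r<l)) 0# l<sl))

    coeff-embed-lastRow : ∀ {c} → c < l → coeff (embed D) l c ≡ 0#
    coeff-embed-lastRow c<l = trans (coeff-< (embed D) l<sl (ℕₚ.m<n⇒m<1+n c<l))
      (trans (cong (λ row → lookup row (fromℕ< (ℕₚ.m<n⇒m<1+n c<l))) row-last)
             (trans (lookup-∷ʳ-< (replicate l 0#) 1# (ℕₚ.m<n⇒m<1+n c<l) c<l) (Vecₚ.lookup-replicate (fromℕ< c<l) 0#)))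

    coeff-embed-corner : coeff (embed D) l l ≡ 1#
    coeff-embed-corner = trans (coeff-< (embed D) l<sl l<sl)
      (trans (cong (λ row → lookup row (fromℕ< l<sl)) row-last) (lookup-∷ʳ-last (replicate l 0#) 1# l<sl))

  embed-lastRow : ∀ {l} (D E : Mat l) {c} → c < suc l → coeff (embed D) l c ≡ coeff (embed E) l c
  embed-lastRow {l} D E c<sl with ℕₚ.m<1+n⇒m<n∨m≡n c<sl
  ... | inj₁ c<l  = trans (coeff-embed-lastRow D c<l) (sym (coeff-embed-lastRow E c<l))
  ... | inj₂ refl = trans (coeff-embed-corner D) (sym (coeff-embed-corner E))

  embed-⊗ : ∀ {l} (D E : Mat l) → embed D ⊗ embed E ≡ embed (D ⊗ E)
  embed-⊗ {l} D E = coeff-ext λ r c r<sl c<sl → entries (ℕₚ.m<1+n⇒m<n∨m≡n r<sl) (ℕₚ.m<1+n⇒m<n∨m≡n c<sl) r<sl c<sl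
    where
    open ≡-Reasoning
    l<sl : l < suc l
    l<sl = ℕₚ.n<1+n l
    entries : ∀ {r c} → r < l ⊎ r ≡ l → c < l ⊎ c ≡ l → r < suc l → c < suc l →
              coeff (embed D ⊗ embed E) r c ≡ coeff (embed (D ⊗ E)) r c
    entries {r} {c} (inj₁ r<l) (inj₁ c<l) r<sl c<sl = begin
      coeff (embed D ⊗ embed E) r c
        ≡⟨ coeff-⊗ (embed D) (embed E) r<sl c<sl ⟩
      ∑ (suc l) (λ k → coeff (embed D) r k * coeff (embed E) k c)
        ≡⟨ ∑-snoc l _ ⟩
      ∑ l (λ k → coeff (embed D) r k * coeff (embed E) k c) + coeff (embed D) r l * coeff (embed E) l c
        ≡⟨ cong₂ _+_ (∑-cong l λ k k<l → cong₂ _*_ (coeff-embed-inner D r<l k<l) (coeff-embed-inner E k<l c<l))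
                     (trans (cong (_* _) (coeff-embed-lastColumn D r<l)) (zeroˡ _)) ⟩
      ∑ l (λ k → coeff D r k * coeff E k c) + 0#
        ≡⟨ +-identityʳ _ ⟩
      ∑ l (λ k → coeff D r k * coeff E k c)
        ≡⟨ coeff-⊗ D E r<l c<l ⟨
      coeff (D ⊗ E) r c
        ≡⟨ coeff-embed-inner (D ⊗ E) r<l c<l ⟨
      coeff (embed (D ⊗ E)) r c ∎
    entries {r} (inj₁ r<l) (inj₂ refl) r<sl c<sl = begin
      coeff (embed D ⊗ embed E) r l
        ≡⟨ coeff-⊗-sparseColumn (embed D) (embed E) r<sl l<sl l<sl (λ m m<sl m≢l →
             coeff-embed-lastColumn E (ℕₚ.≤∧≢⇒< (ℕₚ.m<1+n⇒m≤n m<sl) m≢l)) ⟩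
      coeff (embed D) r l * coeff (embed E) l l ≡⟨ cong (_* _) (coeff-embed-lastColumn D r<l) ⟩
      0# * coeff (embed E) l l                  ≡⟨ zeroˡ _ ⟩
      0#                                        ≡⟨ coeff-embed-lastColumn (D ⊗ E) r<l ⟨
      coeff (embed (D ⊗ E)) r l ∎
    entries {c = c} (inj₂ refl) _ r<sl c<sl = begin
      coeff (embed D ⊗ embed E) l c
        ≡⟨ coeff-⊗-sparseRow (embed D) (embed E) l<sl c<sl l<sl (λ m m<sl m≢l →
             coeff-embed-lastRow D (ℕₚ.≤∧≢⇒< (ℕₚ.m<1+n⇒m≤n m<sl) m≢l)) ⟩
      coeff (embed D) l l * coeff (embed E) l c ≡⟨ cong (_* _) (coeff-embed-corner D) ⟩
      1# * coeff (embed E) l c                  ≡⟨ *-identityˡ _ ⟩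
      coeff (embed E) l c                       ≡⟨ embed-lastRow E (D ⊗ E) c<sl ⟩
      coeff (embed (D ⊗ E)) l c ∎

  Block-embed : ∀ {l} (a b c d : Carrier) {k} → suc k < l → Block {suc l} a b c d k ≡ embed (Block {l} a b c d k)
  Block-embed {l} a b c d {k} sk<l = coeff-ext λ r c′ r<sl c′<sl →
    trans (coeff-Block a b c d k r<sl c′<sl) (entries (ℕₚ.m<1+n⇒m<n∨m≡n r<sl) (ℕₚ.m<1+n⇒m<n∨m≡n c′<sl))
    where
    l≢k : l ≢ k
    l≢k refl = ℕₚ.<-irrefl refl (ℕₚ.<-trans (ℕₚ.n<1+n k) sk<l)
    l≢sk : l ≢ suc k
    l≢sk refl = ℕₚ.<-irrefl refl sk<l
    entries : ∀ {r c′} → r < l ⊎ r ≡ l → c′ < l ⊎ c′ ≡ l →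
              block a b c d k r c′ ≡ coeff (embed (Block a b c d k)) r c′
    entries (inj₁ r<l)  (inj₁ c′<l) = sym (trans (coeff-embed-inner _ r<l c′<l) (coeff-Block a b c d k r<l c′<l))
    entries {r} (inj₁ r<l)  (inj₂ refl) = trans (block-outsideCols a b c d _ l≢k l≢sk)
      (trans (δ-≢ {r} {l} (λ { refl → ℕₚ.<-irrefl refl r<l })) (sym (coeff-embed-lastColumn _ r<l)))
    entries {c′ = c′} (inj₂ refl) (inj₁ c′<l) = trans (block-outsideRows a b c d _ l≢k l≢sk)
      (trans (δ-≢ {l} {c′} (λ { refl → ℕₚ.<-irrefl refl c′<l })) (sym (coeff-embed-lastRow _ c′<l)))
    entries (inj₂ refl) (inj₂ refl) = trans (block-outsideRows a b c d _ l≢k l≢sk)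
      (trans (δ-refl l) (sym (coeff-embed-corner _)))

  sgn-sq : ∀ j → sgn j * sgn j ≡ 1#
  sgn-sq zero    = *-identityˡ 1#
  sgn-sq (suc j) = begin
    (- sgn j) * (- sgn j)   ≡⟨ -‿distribˡ-* (sgn j) (- sgn j) ⟨
    - (sgn j * (- sgn j))   ≡⟨ cong -_ (-‿distribʳ-* (sgn j) (sgn j)) ⟨
    - (- (sgn j * sgn j))   ≡⟨ -‿involutive _ ⟩
    sgn j * sgn j           ≡⟨ sgn-sq j ⟩
    1#                      ∎
    where open ≡-Reasoning

module Generators (F : FiniteField) (l : ℕ) where
  open FiniteField F
  open FF F
  open Matrices F

  B-entry : ℕ → ℕ → Carrier
  B-entry i j = if i ℕ.≡ᵇ suc j then 1# else (if (i ℕ.≡ᵇ 0) ∧ (j ℕ.≡ᵇ l) then sgn l else 0#)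

  B : Mat (suc l)
  B = matB l

  -- B is a signed permutation matrix with signs ±1, so its transpose is its inverse.
  B⁻¹ : Mat (suc l)
  B⁻¹ = fromFun (flip B-entry)

  B^ : ℕ → Mat (suc l)
  B^ i = B ^ᴹ i

  private
    l<sl : l < suc l
    l<sl = ℕₚ.n<1+n l
    0<sl : 0 < suc l
    0<sl = s≤s z≤n
    <l⇒≢l : ∀ {r} → r < l → r ≢ l
    <l⇒≢l r<l refl = ℕₚ.<-irrefl refl r<l

  coeff-B-zero : ∀ {c} → c < suc l → coeff B 0 c ≡ (if c ℕ.≡ᵇ l then sgn l else 0#)
  coeff-B-zero = coeff-fromFun B-entry 0<sl

  coeff-B-suc : ∀ {r c} → suc r < suc l → c < suc l → coeff B (suc r) c ≡ δ r c
  coeff-B-suc = coeff-fromFun B-entry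

  coeff-B⁻¹-zero : ∀ {r} → r < suc l → coeff B⁻¹ r 0 ≡ (if r ℕ.≡ᵇ l then sgn l else 0#)
  coeff-B⁻¹-zero r<sl = coeff-fromFun (flip B-entry) r<sl 0<sl

  coeff-B⁻¹-suc : ∀ {r c} → r < suc l → suc c < suc l → coeff B⁻¹ r (suc c) ≡ δ c r
  coeff-B⁻¹-suc = coeff-fromFun (flip B-entry)

  module _ (X : Mat (suc l)) where

    coeff-B⊗-zero : ∀ {c} → c < suc l → coeff (B ⊗ X) 0 c ≡ sgn l * coeff X l c
    coeff-B⊗-zero c<sl =
      trans (coeff-⊗-sparseRow B X 0<sl c<sl l<sl λ m m<sl m≢l → trans (coeff-B-zero m<sl) (if-≡ᵇ-no m≢l))
            (cong (_* coeff X l _) (trans (coeff-B-zero l<sl) (if-≡ᵇ-yes {m = l} refl)))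

    coeff-B⊗-suc : ∀ {r c} → suc r < suc l → c < suc l → coeff (B ⊗ X) (suc r) c ≡ coeff X r c
    coeff-B⊗-suc {r} sr<sl c<sl =
      trans (coeff-⊗-sparseRow B X sr<sl c<sl r<sl (λ m m<sl m≢r → trans (coeff-B-suc sr<sl m<sl) (δ-≢ (m≢r ∘ sym))))
            (trans (cong (_* coeff X r _) (trans (coeff-B-suc sr<sl r<sl) (δ-refl r))) (*-identityˡ _))
      where r<sl = ℕₚ.<-trans (ℕₚ.n<1+n r) sr<sl

    coeff-⊗B-< : ∀ {r c} → r < suc l → c < l → coeff (X ⊗ B) r c ≡ coeff X r (suc c)
    coeff-⊗B-< {r} {c} r<sl c<l =
      trans (coeff-⊗-sparseColumn X B r<sl c<sl (s≤s c<l) column)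
            (trans (cong (coeff X r (suc c) *_) (trans (coeff-B-suc (s≤s c<l) c<sl) (δ-refl c))) (*-identityʳ _))
      where
      c<sl = ℕₚ.m<n⇒m<1+n c<l
      column : ∀ m → m < suc l → m ≢ suc c → coeff B m c ≡ 0#
      column zero    _    _     = trans (coeff-B-zero c<sl) (if-≡ᵇ-no (<l⇒≢l c<l))
      column (suc m) m<sl m≢sc = trans (coeff-B-suc m<sl c<sl) (δ-≢ (m≢sc ∘ cong suc))

    coeff-⊗B-last : ∀ {r} → r < suc l → coeff (X ⊗ B) r l ≡ coeff X r 0 * sgn l
    coeff-⊗B-last r<sl =
      trans (coeff-⊗-sparseColumn X B r<sl l<sl 0<sl column)
            (cong (coeff X _ 0 *_) (trans (coeff-B-zero l<sl) (if-≡ᵇ-yes {m = l} refl)))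
      where
      column : ∀ m → m < suc l → m ≢ 0 → coeff B m l ≡ 0#
      column zero    _    0≢0 = contradiction refl 0≢0
      column (suc m) m<sl _   = trans (coeff-B-suc m<sl l<sl) (δ-≢ (<l⇒≢l (ℕ.s<s⁻¹ m<sl)))

    coeff-⊗B⁻¹-zero : ∀ {r} → r < suc l → coeff (X ⊗ B⁻¹) r 0 ≡ coeff X r l * sgn l
    coeff-⊗B⁻¹-zero r<sl =
      trans (coeff-⊗-sparseColumn X B⁻¹ r<sl 0<sl l<sl λ m m<sl m≢l → trans (coeff-B⁻¹-zero m<sl) (if-≡ᵇ-no m≢l))
            (cong (coeff X _ l *_) (trans (coeff-B⁻¹-zero l<sl) (if-≡ᵇ-yes {m = l} refl)))

    coeff-⊗B⁻¹-suc : ∀ {r c} → r < suc l → suc c < suc l → coeff (X ⊗ B⁻¹) r (suc c) ≡ coeff X r c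
    coeff-⊗B⁻¹-suc {r} {c} r<sl sc<sl =
      trans (coeff-⊗-sparseColumn X B⁻¹ r<sl sc<sl c<sl λ m m<sl m≢c →
               trans (coeff-B⁻¹-suc m<sl sc<sl) (δ-≢ (m≢c ∘ sym)))
            (trans (cong (coeff X r c *_) (trans (coeff-B⁻¹-suc c<sl sc<sl) (δ-refl c))) (*-identityʳ _))
      where c<sl = ℕₚ.<-trans (ℕₚ.n<1+n c) sc<sl

  B⊗B⁻¹ : B ⊗ B⁻¹ ≡ I
  B⊗B⁻¹ = coeff-ext entries
    where
    entries : ∀ r c → r < suc l → c < suc l → coeff (B ⊗ B⁻¹) r c ≡ coeff (I {suc l}) r c
    entries r       zero    r<sl c<sl = trans (coeff-⊗B⁻¹-zero B r<sl) (trans (last-column r r<sl) (sym (coeff-I r<sl c<sl)))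
      where
      last-column : ∀ r → r < suc l → coeff B r l * sgn l ≡ δ r 0
      last-column zero    _    = trans (cong (_* sgn l) (trans (coeff-B-zero l<sl) (if-≡ᵇ-yes {m = l} refl))) (sgn-sq l)
      last-column (suc r) r<sl = trans (cong (_* sgn l) (trans (coeff-B-suc r<sl l<sl) (δ-≢ (<l⇒≢l (ℕ.s<s⁻¹ r<sl)))))
                                       (zeroˡ _)
    entries r (suc c) r<sl sc<sl = trans (coeff-⊗B⁻¹-suc B r<sl sc<sl) (trans (column r r<sl) (sym (coeff-I r<sl sc<sl)))
      where
      column : ∀ r → r < suc l → coeff B r c ≡ δ r (suc c)
      column zero    _    = trans (coeff-B-zero (ℕₚ.<-trans (ℕₚ.n<1+n c) sc<sl)) (if-≡ᵇ-no (<l⇒≢l (ℕ.s<s⁻¹ sc<sl)))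
      column (suc r) r<sl = coeff-B-suc r<sl (ℕₚ.<-trans (ℕₚ.n<1+n c) sc<sl)

  B^-suc : ∀ i → B^ i ⊗ B ≡ B^ (suc i)
  B^-suc zero    = trans (⊗-identityˡ B) (sym (⊗-identityʳ B))
  B^-suc (suc i) = trans (⊗-assoc B (B^ i) B) (cong (B ⊗_) (B^-suc i))

  B^-inverse : ∀ j → B^ j ⊗ (B⁻¹ ^ᴹ j) ≡ I
  B^-inverse zero    = ⊗-identityˡ I
  B^-inverse (suc j) = begin
    B^ (suc j) ⊗ (B⁻¹ ⊗ (B⁻¹ ^ᴹ j))   ≡⟨ cong (_⊗ (B⁻¹ ⊗ (B⁻¹ ^ᴹ j))) (B^-suc j) ⟨
    (B^ j ⊗ B) ⊗ (B⁻¹ ⊗ (B⁻¹ ^ᴹ j))   ≡⟨ ⊗-assoc (B^ j) B (B⁻¹ ⊗ (B⁻¹ ^ᴹ j)) ⟩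
    B^ j ⊗ (B ⊗ (B⁻¹ ⊗ (B⁻¹ ^ᴹ j)))   ≡⟨ cong (B^ j ⊗_) (⊗-assoc B B⁻¹ (B⁻¹ ^ᴹ j)) ⟨
    B^ j ⊗ ((B ⊗ B⁻¹) ⊗ (B⁻¹ ^ᴹ j))   ≡⟨ cong (λ X → B^ j ⊗ (X ⊗ (B⁻¹ ^ᴹ j))) B⊗B⁻¹ ⟩
    B^ j ⊗ (I ⊗ (B⁻¹ ^ᴹ j))           ≡⟨ cong (B^ j ⊗_) (⊗-identityˡ (B⁻¹ ^ᴹ j)) ⟩
    B^ j ⊗ (B⁻¹ ^ᴹ j)                 ≡⟨ B^-inverse j ⟩
    I                                 ∎
    where open ≡-Reasoning

  ⊗B^-cancel : ∀ {X Y} j → X ⊗ B^ j ≡ Y ⊗ B^ j → X ≡ Y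
  ⊗B^-cancel {X} {Y} j = ⊗-cancelʳ {M = X} {Y} {B^ j} {B⁻¹ ^ᴹ j} (B^-inverse j)

  module _ (w x y z : Carrier) where

    B⊗Block : ∀ {k} → suc (suc k) < suc l → B ⊗ Block w x y z k ≡ Block w x y z (suc k) ⊗ B
    B⊗Block {k} ssk<sl = coeff-ext entries
      where
      X : ℕ → Mat (suc l)
      X = Block w x y z
      sk<l : suc k < l
      sk<l = ℕ.s<s⁻¹ ssk<sl
      l≢k : l ≢ k
      l≢k l≡k = ℕₚ.<-irrefl (sym l≡k) (ℕₚ.<-trans (ℕₚ.n<1+n k) sk<l)
      l≢sk : l ≢ suc k
      l≢sk l≡sk = ℕₚ.<-irrefl (sym l≡sk) sk<l
      entries : ∀ r c → r < suc l → c < suc l → coeff (B ⊗ X k) r c ≡ coeff (X (suc k) ⊗ B) r c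
      entries r c r<sl c<sl with ℕₚ.m<1+n⇒m<n∨m≡n c<sl | r
      ... | inj₁ c<l | zero = begin
        coeff (B ⊗ X k) 0 c               ≡⟨ coeff-B⊗-zero (X k) c<sl ⟩
        sgn l * coeff (X k) l c           ≡⟨ cong (sgn l *_) (trans (coeff-Block w x y z k l<sl c<sl)
                                               (trans (block-outsideRows w x y z c l≢k l≢sk) (δ-≢ (<l⇒≢l c<l ∘ sym)))) ⟩
        sgn l * 0#                        ≡⟨ zeroʳ _ ⟩
        0#                                ≡⟨ coeff-Block w x y z (suc k) 0<sl (s≤s c<l) ⟨
        coeff (X (suc k)) 0 (suc c)       ≡⟨ coeff-⊗B-< (X (suc k)) 0<sl c<l ⟨
        coeff (X (suc k) ⊗ B) 0 c         ∎
        where open ≡-Reasoning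
      ... | inj₂ refl | zero = begin
        coeff (B ⊗ X k) 0 l               ≡⟨ coeff-B⊗-zero (X k) l<sl ⟩
        sgn l * coeff (X k) l l           ≡⟨ cong (sgn l *_) (trans (coeff-Block w x y z k l<sl l<sl)
                                               (trans (block-outsideRows w x y z l l≢k l≢sk) (δ-refl l))) ⟩
        sgn l * 1#                        ≡⟨ *-comm _ _ ⟩
        1# * sgn l                        ≡⟨ cong (_* sgn l) (coeff-Block w x y z (suc k) 0<sl 0<sl) ⟨
        coeff (X (suc k)) 0 0 * sgn l     ≡⟨ coeff-⊗B-last (X (suc k)) 0<sl ⟨
        coeff (X (suc k) ⊗ B) 0 l         ∎
        where open ≡-Reasoning
      ... | inj₁ c<l | suc r′ = begin
        coeff (B ⊗ X k) (suc r′) c        ≡⟨ coeff-B⊗-suc (X k) r<sl c<sl ⟩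
        coeff (X k) r′ c                  ≡⟨ coeff-Block w x y z k (ℕₚ.<-trans (ℕₚ.n<1+n r′) r<sl) c<sl ⟩
        block w x y z k r′ c             ≡⟨ coeff-Block w x y z (suc k) r<sl (s≤s c<l) ⟨
        coeff (X (suc k)) (suc r′) (suc c) ≡⟨ coeff-⊗B-< (X (suc k)) r<sl c<l ⟨
        coeff (X (suc k) ⊗ B) (suc r′) c  ∎
        where open ≡-Reasoning
      ... | inj₂ refl | suc r′ = begin
        coeff (B ⊗ X k) (suc r′) l        ≡⟨ coeff-B⊗-suc (X k) r<sl l<sl ⟩
        coeff (X k) r′ l                  ≡⟨ coeff-Block w x y z k (ℕₚ.<-trans (ℕₚ.n<1+n r′) r<sl) l<sl ⟩
        block w x y z k r′ l             ≡⟨ block-outsideCols w x y z r′ l≢k l≢sk ⟩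
        δ r′ l                            ≡⟨ δ-≢ (<l⇒≢l (ℕ.s<s⁻¹ r<sl)) ⟩
        0#                                ≡⟨ zeroˡ _ ⟨
        0# * sgn l                        ≡⟨ cong (_* sgn l) (coeff-Block w x y z (suc k) r<sl 0<sl) ⟨
        coeff (X (suc k)) (suc r′) 0 * sgn l ≡⟨ coeff-⊗B-last (X (suc k)) r<sl ⟨
        coeff (X (suc k) ⊗ B) (suc r′) l  ∎
        where open ≡-Reasoning

    B^⊗Block : ∀ i → i < l → B^ i ⊗ Block w x y z 0 ≡ Block w x y z i ⊗ B^ i
    B^⊗Block zero    _     = trans (⊗-identityˡ (Block w x y z 0)) (sym (⊗-identityʳ (Block w x y z 0)))
    B^⊗Block (suc i) si<l = begin
      (B ⊗ B^ i) ⊗ Block w x y z 0         ≡⟨ ⊗-assoc B (B^ i) (Block w x y z 0) ⟩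
      B ⊗ (B^ i ⊗ Block w x y z 0)         ≡⟨ cong (B ⊗_) (B^⊗Block i (ℕₚ.<-trans (ℕₚ.n<1+n i) si<l)) ⟩
      B ⊗ (Block w x y z i ⊗ B^ i)         ≡⟨ ⊗-assoc B (Block w x y z i) (B^ i) ⟨
      (B ⊗ Block w x y z i) ⊗ B^ i         ≡⟨ cong (_⊗ B^ i) (B⊗Block (s≤s si<l)) ⟩
      (Block w x y z (suc i) ⊗ B) ⊗ B^ i   ≡⟨ ⊗-assoc (Block w x y z (suc i)) B (B^ i) ⟩
      Block w x y z (suc i) ⊗ (B ⊗ B^ i)   ∎
      where open ≡-Reasoning

  lastRow-B^ : ∀ j → j ≤ l → ∀ {c} → c < suc l → coeff (B^ j) l c ≡ δ (c ℕ.+ j) l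
  lastRow-B^ zero    _     {c} c<sl = begin
    coeff I l c       ≡⟨ coeff-I l<sl c<sl ⟩
    δ l c             ≡⟨ δ-sym l c ⟩
    δ c l             ≡⟨ cong (λ x → δ x l) (ℕₚ.+-identityʳ c) ⟨
    δ (c ℕ.+ 0) l     ∎
    where open ≡-Reasoning
  lastRow-B^ (suc j) sj≤l {c} c<sl with ℕₚ.m<1+n⇒m<n∨m≡n c<sl
  ... | inj₁ c<l = begin
    coeff (B^ (suc j)) l c        ≡⟨ cong (λ X → coeff X l c) (B^-suc j) ⟨
    coeff (B^ j ⊗ B) l c          ≡⟨ coeff-⊗B-< (B^ j) l<sl c<l ⟩
    coeff (B^ j) l (suc c)        ≡⟨ lastRow-B^ j (ℕₚ.<⇒≤ sj≤l) (s≤s c<l) ⟩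
    δ (suc c ℕ.+ j) l             ≡⟨ cong (λ x → δ x l) (ℕₚ.+-suc c j) ⟨
    δ (c ℕ.+ suc j) l             ∎
    where open ≡-Reasoning
  ... | inj₂ refl = begin
    coeff (B^ (suc j)) l l        ≡⟨ cong (λ X → coeff X l l) (B^-suc j) ⟨
    coeff (B^ j ⊗ B) l l          ≡⟨ coeff-⊗B-last (B^ j) l<sl ⟩
    coeff (B^ j) l 0 * sgn l      ≡⟨ cong (_* sgn l) (lastRow-B^ j (ℕₚ.<⇒≤ sj≤l) 0<sl) ⟩
    δ j l * sgn l                 ≡⟨ cong (_* sgn l) (δ-≢ (<l⇒≢l sj≤l)) ⟩
    0# * sgn l                    ≡⟨ zeroˡ _ ⟩
    0#                            ≡⟨ δ-≢ (λ e → ℕₚ.<-irrefl (sym e) (ℕₚ.m<m+n l {suc j} (s≤s z≤n))) ⟨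
    δ (l ℕ.+ suc j) l             ∎
    where open ≡-Reasoning

  lastRow-embed⊗B^ : ∀ (D : Mat l) j → j ≤ l → ∀ {c} → c < suc l → coeff (embed D ⊗ B^ j) l c ≡ δ (c ℕ.+ j) l
  lastRow-embed⊗B^ D j j≤l {c} c<sl = begin
    coeff (embed D ⊗ B^ j) l c
      ≡⟨ coeff-⊗-sparseRow (embed D) (B^ j) l<sl c<sl l<sl (λ m m<sl m≢l →
           coeff-embed-lastRow D (ℕₚ.≤∧≢⇒< (ℕₚ.m<1+n⇒m≤n m<sl) m≢l)) ⟩
    coeff (embed D) l l * coeff (B^ j) l c ≡⟨ cong (_* coeff (B^ j) l c) (coeff-embed-corner D) ⟩
    1# * coeff (B^ j) l c                  ≡⟨ *-identityˡ _ ⟩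
    coeff (B^ j) l c                       ≡⟨ lastRow-B^ j j≤l c<sl ⟩
    δ (c ℕ.+ j) l                          ∎
    where open ≡-Reasoning

  embed⊗B^-injective : ∀ {D D′ : Mat l} {j j′} → j < l → j′ < l →
                       embed D ⊗ B^ j ≡ embed D′ ⊗ B^ j′ → j ≡ j′ × embed D ≡ embed D′
  embed⊗B^-injective {D} {D′} {j} {j′} j<l j′<l eq with j ℕ.≟ j′
  ... | yes refl = refl , ⊗B^-cancel j eq
  ... | no j≢j′  = contradiction (trans (sym (trans (cong (λ X → coeff X l (l ∸ j)) eq) zero-one-entry)) one-entry) 0≢1
    where
    l∸j+j≡l : l ∸ j ℕ.+ j ≡ l
    l∸j+j≡l = ℕₚ.m∸n+n≡m (ℕₚ.<⇒≤ j<l)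
    l∸j<sl : l ∸ j < suc l
    l∸j<sl = s≤s (ℕₚ.m∸n≤m l j)
    one-entry : coeff (embed D ⊗ B^ j) l (l ∸ j) ≡ 1#
    one-entry = trans (lastRow-embed⊗B^ D j (ℕₚ.<⇒≤ j<l) l∸j<sl) (trans (cong (λ x → δ x l) l∸j+j≡l) (δ-refl l))
    zero-one-entry : coeff (embed D′ ⊗ B^ j′) l (l ∸ j) ≡ 0#
    zero-one-entry = trans (lastRow-embed⊗B^ D′ j′ (ℕₚ.<⇒≤ j′<l) l∸j<sl)
                   (δ-≢ λ e → j≢j′ (sym (ℕₚ.+-cancelˡ-≡ (l ∸ j) j′ j (trans e (sym l∸j+j≡l)))))

  InS-embed⊗B^ : ∀ {D : Mat l} {i} → i < l → InSL D → InS l (embed D ⊗ B^ i)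
  InS-embed⊗B^ {D} {i} i<l D∈SL = i , i<l , embed D , (D , D∈SL , refl) , refl

  PreservesDet : (w x y z : Carrier) → Set
  PreservesDet w x y z = ∀ (D : Mat l) {k} → suc k < l → det (D ⊗ Block w x y z k) ≡ det D

  InS-⊗Block : ∀ {w x y z} → PreservesDet w x y z → ∀ {D : Mat l} {i} → suc i < l → InSL D →
               InS l ((embed D ⊗ B^ i) ⊗ Block w x y z 0)
  InS-⊗Block {w} {x} {y} {z} preserves {D} {i} si<l D∈SL =
    i , i<l , embed (D ⊗ Y) , (D ⊗ Y , trans (preserves D si<l) D∈SL , refl) , conjugate
    where
    open ≡-Reasoning
    i<l = ℕₚ.<-trans (ℕₚ.n<1+n i) si<l
    Y : Mat l
    Y = Block w x y z i
    conjugate : (embed D ⊗ B^ i) ⊗ Block w x y z 0 ≡ embed (D ⊗ Y) ⊗ B^ i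
    conjugate = begin
      (embed D ⊗ B^ i) ⊗ Block w x y z 0   ≡⟨ ⊗-assoc (embed D) (B^ i) (Block w x y z 0) ⟩
      embed D ⊗ (B^ i ⊗ Block w x y z 0)   ≡⟨ cong (embed D ⊗_) (B^⊗Block w x y z i i<l) ⟩
      embed D ⊗ (Block w x y z i ⊗ B^ i)   ≡⟨ ⊗-assoc (embed D) (Block w x y z i) (B^ i) ⟨
      (embed D ⊗ Block w x y z i) ⊗ B^ i   ≡⟨ cong (λ X → (embed D ⊗ X) ⊗ B^ i) (Block-embed w x y z si<l) ⟩
      (embed D ⊗ embed Y) ⊗ B^ i           ≡⟨ cong (_⊗ B^ i) (embed-⊗ D Y) ⟩
      embed (D ⊗ Y) ⊗ B^ i                 ∎

  column1-B^ : ∀ i → i < l → ∀ {k} → k < suc l → coeff (B^ i) k 1 ≡ δ k (suc i)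
  column1-B^ zero    0<l k<sl = coeff-I k<sl (s≤s 0<l)
  column1-B^ (suc i) si<l {zero} _ = begin
    coeff (B ⊗ B^ i) 0 1          ≡⟨ coeff-B⊗-zero (B^ i) (s≤s (ℕₚ.≤-<-trans z≤n si<l)) ⟩
    sgn l * coeff (B^ i) l 1      ≡⟨ cong (sgn l *_) (column1-B^ i (ℕₚ.<-trans (ℕₚ.n<1+n i) si<l) l<sl) ⟩
    sgn l * δ l (suc i)           ≡⟨ cong (sgn l *_) (δ-≢ λ l≡si → ℕₚ.<-irrefl (sym l≡si) si<l) ⟩
    sgn l * 0#                    ≡⟨ zeroʳ _ ⟩
    0#                            ∎
    where open ≡-Reasoning
  column1-B^ (suc i) si<l {suc k} k<sl =
    trans (coeff-B⊗-suc (B^ i) k<sl (s≤s (ℕₚ.≤-<-trans z≤n si<l)))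
          (column1-B^ i (ℕₚ.<-trans (ℕₚ.n<1+n i) si<l) (ℕₚ.<-trans (ℕₚ.n<1+n k) k<sl))

  column1-embed⊗B^ : ∀ (D : Mat l) {i} → i < l → ∀ {r} → r < suc l →
                     coeff (embed D ⊗ B^ i) r 1 ≡ coeff (embed D) r (suc i)
  column1-embed⊗B^ D {i} i<l {r} r<sl = trans
    (coeff-⊗-sparseColumn (embed D) (B^ i) r<sl (s≤s (ℕₚ.≤-<-trans z≤n i<l)) (s≤s i<l) λ k k<sl k≢si →
      trans (column1-B^ i i<l k<sl) (δ-≢ k≢si))
    (trans (cong (coeff (embed D) r (suc i) *_) (trans (column1-B^ i i<l (s≤s i<l)) (δ-refl (suc i)))) (*-identityʳ _))

  embed⊗B^-column1≢0 : ∀ {D : Mat l} {i} → i < l → InSL D → ¬ (∀ r → r < suc l → coeff (embed D ⊗ B^ i) r 1 ≡ 0#)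
  embed⊗B^-column1≢0 {D} {i} i<l D∈SL column≡0 with ℕₚ.m≤n⇒m<n∨m≡n i<l
  ... | inj₁ si<l = 0≢1 (trans (sym (det-zero-column D si<l λ r r<l → begin
                      coeff D r (suc i)              ≡⟨ coeff-embed-inner D r<l si<l ⟨
                      coeff (embed D) r (suc i)      ≡⟨ column1-embed⊗B^ D i<l (ℕₚ.m<n⇒m<1+n r<l) ⟨
                      coeff (embed D ⊗ B^ i) r 1     ≡⟨ column≡0 r (ℕₚ.m<n⇒m<1+n r<l) ⟩
                      0#                             ∎))
                     D∈SL)
    where open ≡-Reasoning
  ... | inj₂ refl = 0≢1 (trans (sym (column≡0 l l<sl)) (trans (column1-embed⊗B^ D i<l l<sl) (coeff-embed-corner D)))

module Boundary (F : FiniteField) (l : ℕ) (1≤l : 1 ≤ l) (g : FiniteField.Carrier F) where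
  open FiniteField F
  open FF F
  open Matrices F
  open Generators F l

  private
    1<sl : 1 < suc l
    1<sl = s≤s 1≤l

  A A⁻¹ C C⁻¹ : Mat (suc l)
  A   = Block 1# 1# 0# 1# 0
  A⁻¹ = Block 1# (- 1#) 0# 1# 0
  C   = Block (g ⁻¹) 0# 0# g 0
  C⁻¹ = Block g 0# 0# (g ⁻¹) 0

  matA≡A : matA l ≡ A
  matA≡A = fromFun-cong entries
    where
    entries : ∀ i j → (if i ℕ.≡ᵇ j then 1# else (if (i ℕ.≡ᵇ 0) ∧ (j ℕ.≡ᵇ 1) then 1# else 0#)) ≡
                      block 1# 1# 0# 1# 0 i j
    entries zero          zero          = refl
    entries zero          (suc zero)    = refl
    entries zero          (suc (suc j)) = refl
    entries (suc zero)    zero          = refl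
    entries (suc zero)    (suc zero)    = refl
    entries (suc zero)    (suc (suc j)) = refl
    entries (suc (suc i)) zero          = refl
    entries (suc (suc i)) (suc zero)    = refl
    entries (suc (suc i)) (suc (suc j)) = refl

  matC≡C : matC l g ≡ C
  matC≡C = fromFun-cong entries
    where
    entries : ∀ i j → (if i ℕ.≡ᵇ j then (if i ℕ.≡ᵇ 0 then g ⁻¹ else (if i ℕ.≡ᵇ 1 then g else 1#)) else 0#) ≡
                      block (g ⁻¹) 0# 0# g 0 i j
    entries zero          zero          = refl
    entries zero          (suc zero)    = refl
    entries zero          (suc (suc j)) = refl
    entries (suc zero)    zero          = refl
    entries (suc zero)    (suc zero)    = refl
    entries (suc zero)    (suc (suc j)) = refl
    entries (suc (suc i)) zero          = refl
    entries (suc (suc i)) (suc zero)    = refl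
    entries (suc (suc i)) (suc (suc j)) = refl

  A⊗A⁻¹ : A ⊗ A⁻¹ ≡ I
  A⊗A⁻¹ = Block-inverse 1<sl
    (trans (x+y*0≡x (1# * 1#) 1#) (*-identityˡ 1#))
    (trans (cong₂ _+_ (*-identityˡ (- 1#)) (*-identityˡ 1#)) (-‿inverseˡ 1#))
    (trans (x+y*0≡x (0# * 1#) 1#) (zeroˡ 1#))
    (trans (cong (_+ 1# * 1#) (zeroˡ (- 1#))) (trans (+-identityˡ _) (*-identityˡ 1#)))

  module _ (g≢0 : g ≢ 0#) where

    g*g⁻¹ : g * g ⁻¹ ≡ 1#
    g*g⁻¹ = inverseʳ g g≢0

    g⁻¹*g : g ⁻¹ * g ≡ 1#
    g⁻¹*g = trans (*-comm (g ⁻¹) g) g*g⁻¹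

    C⊗C⁻¹ : C ⊗ C⁻¹ ≡ I
    C⊗C⁻¹ = Block-inverse 1<sl
      (trans (x+y*0≡x (g ⁻¹ * g) 0#) g⁻¹*g)
      (trans (x*0+y≡y (g ⁻¹) (0# * g ⁻¹)) (zeroˡ _))
      (trans (x+y*0≡x (0# * g) g) (zeroˡ g))
      (trans (x*0+y≡y 0# (g * g ⁻¹)) g*g⁻¹)

  shear-preserves : ∀ x → PreservesDet 1# x 0# 1#
  shear-preserves x D sk<l = det-⊗-shear D sk<l x

  diagonal-preserves : ∀ {u v} → u * v ≡ 1# → PreservesDet u 0# 0# v
  diagonal-preserves {u} {v} u*v≡1 D {k} sk<l = begin
    det (D ⊗ Block u 0# 0# v k) ≡⟨ det-⊗-diagonal D sk<l u v ⟩
    u * (v * det D)             ≡⟨ *-assoc u v _ ⟨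
    u * v * det D               ≡⟨ cong (_* det D) u*v≡1 ⟩
    1# * det D                  ≡⟨ *-identityˡ _ ⟩
    det D                       ∎
    where open ≡-Reasoning

  exit : Fin 6 → Mat (suc l)
  exit 0F = B^ (l ∸ 1) ⊗ A⁻¹
  exit 1F = B^ (l ∸ 1) ⊗ A
  exit 2F = B^ (l ∸ 1) ⊗ C⁻¹
  exit 3F = B^ (l ∸ 1) ⊗ C
  exit 4F = B^ 0 ⊗ B⁻¹
  exit 5F = B^ (l ∸ 1) ⊗ B

  ExitForm : Mat (suc l) → Set
  ExitForm M = ∃[ D ] (InSL {l} D × ∃[ k ] (M ≡ embed D ⊗ exit k))

  last-or-earlier : ∀ {i} → i < l → suc i < l ⊎ i ≡ l ∸ 1
  last-or-earlier i<l with ℕₚ.m≤n⇒m<n∨m≡n i<l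
  ... | inj₁ si<l = inj₁ si<l
  ... | inj₂ si≡l = inj₂ (cong ℕ.pred si≡l)

  module _ {M : Mat (suc l)} (M∉S : ¬ InS l M) {D : Mat l} (D∈SL : InSL D) {i} (i<l : i < l) where

    leave-by-block : ∀ {w x y z} → PreservesDet w x y z → ∀ k → exit k ≡ B^ (l ∸ 1) ⊗ Block w x y z 0 →
                     M ≡ (embed D ⊗ B^ i) ⊗ Block w x y z 0 → ExitForm M
    leave-by-block {w} {x} {y} {z} preserves k exit≡ M≡ with last-or-earlier i<l
    ... | inj₁ si<l = contradiction (subst (InS l) (sym M≡) (InS-⊗Block preserves si<l D∈SL)) M∉S
    ... | inj₂ refl = D , D∈SL , k ,
      trans M≡ (trans (⊗-assoc (embed D) (B^ i) (Block w x y z 0)) (cong (embed D ⊗_) (sym exit≡)))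

    leave-by-B : M ≡ (embed D ⊗ B^ i) ⊗ B → ExitForm M
    leave-by-B M≡ with last-or-earlier i<l
    ... | inj₁ si<l = contradiction (subst (InS l) (sym M≡′) (InS-embed⊗B^ si<l D∈SL)) M∉S
      where
      M≡′ : M ≡ embed D ⊗ B^ (suc i)
      M≡′ = trans M≡ (trans (⊗-assoc (embed D) (B^ i) B) (cong (embed D ⊗_) (B^-suc i)))
    ... | inj₂ refl = D , D∈SL , 5F , trans M≡ (⊗-assoc (embed D) (B^ i) B)

  leave-by-B⁻¹ : ∀ {M : Mat (suc l)} → ¬ InS l M → ∀ {D : Mat l} → InSL D → ∀ i → i < l →
                 M ≡ (embed D ⊗ B^ i) ⊗ B⁻¹ → ExitForm M
  leave-by-B⁻¹ M∉S {D} D∈SL zero    _   M≡ = D , D∈SL , 4F , trans M≡ (⊗-assoc (embed D) (B^ 0) B⁻¹)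
  leave-by-B⁻¹ {M} M∉S {D} D∈SL (suc i) i<l M≡ =
    contradiction (subst (InS l) (sym M≡′) (InS-embed⊗B^ (ℕₚ.<-trans (ℕₚ.n<1+n i) i<l) D∈SL)) M∉S
    where
    open ≡-Reasoning
    M≡′ : M ≡ embed D ⊗ B^ i
    M≡′ = begin
      M                                 ≡⟨ M≡ ⟩
      (embed D ⊗ B^ (suc i)) ⊗ B⁻¹      ≡⟨ ⊗-assoc (embed D) (B^ (suc i)) B⁻¹ ⟩
      embed D ⊗ (B^ (suc i) ⊗ B⁻¹)      ≡⟨ cong (λ X → embed D ⊗ (X ⊗ B⁻¹)) (B^-suc i) ⟨
      embed D ⊗ ((B^ i ⊗ B) ⊗ B⁻¹)      ≡⟨ cong (embed D ⊗_) (⊗-assoc (B^ i) B B⁻¹) ⟩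
      embed D ⊗ (B^ i ⊗ (B ⊗ B⁻¹))      ≡⟨ cong (λ X → embed D ⊗ (B^ i ⊗ X)) B⊗B⁻¹ ⟩
      embed D ⊗ (B^ i ⊗ I)              ≡⟨ cong (embed D ⊗_) (⊗-identityʳ (B^ i)) ⟩
      embed D ⊗ B^ i                    ∎

  -- Over GF(2), g = 0 satisfies FF.IsGenerator; then C has a zero column and no C-edge meets S.
  column1-⊗C : g ≡ 0# → ∀ (X : Mat (suc l)) {r} → r < suc l → coeff (X ⊗ C) r 1 ≡ 0#
  column1-⊗C g≡0 X {r} r<sl = begin
    coeff (X ⊗ C) r 1                    ≡⟨ coeff-⊗-Block-right (g ⁻¹) 0# 0# g 1<sl X r<sl ⟩
    coeff X r 0 * 0# + coeff X r 1 * g   ≡⟨ x*0+y≡y _ _ ⟩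
    coeff X r 1 * g                      ≡⟨ cong (coeff X r 1 *_) g≡0 ⟩
    coeff X r 1 * 0#                     ≡⟨ zeroʳ _ ⟩
    0#                                   ∎
    where open ≡-Reasoning

  boundary-form : ∀ {M} → InBoundary l g M → ExitForm M
  boundary-form {M} (_ , M∉S , _ , (i , i<l , _ , (D , D∈SL , refl) , refl) , t , t∈T , M⊗t≡N) = by-generator t∈T
    where
    N : Mat (suc l)
    N = embed D ⊗ B^ i
    leave : ∀ X X⁻¹ → X ⊗ X⁻¹ ≡ I → M ⊗ X ≡ N → M ≡ N ⊗ X⁻¹
    leave X X⁻¹ X⊗X⁻¹≡I = ⊗-moveʳ {M = M} {N} {X} {X⁻¹} X⊗X⁻¹≡I
    by-generator : InT l g t → ExitForm M
    by-generator (inj₁ refl) =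
      leave-by-block M∉S D∈SL i<l (shear-preserves (- 1#)) 0F refl
        (leave A A⁻¹ A⊗A⁻¹ (subst (λ X → M ⊗ X ≡ N) matA≡A M⊗t≡N))
    by-generator (inj₂ (inj₁ refl)) =
      leave-by-B⁻¹ M∉S D∈SL i i<l (leave B B⁻¹ B⊗B⁻¹ M⊗t≡N)
    by-generator (inj₂ (inj₂ (inj₁ refl))) with g ≟ 0#
    ... | yes g≡0 = contradiction (λ r r<sl → trans (cong (λ X → coeff X r 1) (sym M⊗C≡N)) (column1-⊗C g≡0 M r<sl))
                                  (embed⊗B^-column1≢0 i<l D∈SL)
      where
      M⊗C≡N : M ⊗ C ≡ N
      M⊗C≡N = subst (λ X → M ⊗ X ≡ N) matC≡C M⊗t≡N
    ... | no g≢0  =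
      leave-by-block M∉S D∈SL i<l (diagonal-preserves (g*g⁻¹ g≢0)) 2F refl
        (leave C C⁻¹ (C⊗C⁻¹ g≢0) (subst (λ X → M ⊗ X ≡ N) matC≡C M⊗t≡N))
    by-generator (inj₂ (inj₂ (inj₂ (inj₁ t⊗A≡I)))) =
      leave-by-block M∉S D∈SL i<l (shear-preserves 1#) 1F refl
        (subst (λ X → M ≡ N ⊗ X) matA≡A (leave t (matA l) t⊗A≡I M⊗t≡N))
    by-generator (inj₂ (inj₂ (inj₂ (inj₂ (inj₁ t⊗B≡I))))) =
      leave-by-B M∉S D∈SL i<l (leave t B t⊗B≡I M⊗t≡N)
    by-generator (inj₂ (inj₂ (inj₂ (inj₂ (inj₂ t⊗C≡I))))) with g ≟ 0#
    ... | yes g≡0 = ⊥-elim (0≢1 (trans (sym (column1-⊗C g≡0 t 1<sl))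
                               (trans (cong (λ X → coeff X 1 1) t⊗C≡I′) (trans (coeff-I 1<sl 1<sl) (δ-refl 1)))))
      where
      t⊗C≡I′ : t ⊗ C ≡ I
      t⊗C≡I′ = subst (λ X → t ⊗ X ≡ I) matC≡C t⊗C≡I
    ... | no g≢0  =
      leave-by-block M∉S D∈SL i<l (diagonal-preserves (g⁻¹*g g≢0)) 3F refl
        (subst (λ X → M ≡ N ⊗ X) matC≡C (leave t (matC l g) t⊗C≡I M⊗t≡N))

open import Data.Nat using (ℕ; suc; _*_; _≤_)
open import Data.List using (List; length)
open import Data.List.Membership.Propositional using (_∈_)
open import Data.List.Relation.Unary.Unique.Propositional using (Unique)
open import Function.Bundles using (_⇔_)

lemma21 : (F : FiniteField) (l : ℕ) → 1 ≤ l
    → (g : FiniteField.Carrier F) → FF.IsGenerator F g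
    → (LS L∂ : List (FF.Mat F (suc l)))
    → Unique LS → (∀ M → (M ∈ LS) ⇔ FF.InS F l M)
    → Unique L∂ → (∀ M → (M ∈ L∂) ⇔ FF.InBoundary F l g M)
    → l * length L∂ ≤ 6 * length LS
lemma21 F l 1≤l g _ LS L∂ _ LS⇔S unique∂ L∂⇔∂ = *-≤-from-injection exit-kind coset-position injective
  where
  open FF F using (_⊗_; embed)
  open Generators F l using (B^; InS-embed⊗B^; embed⊗B^-injective)
  open Boundary F l 1≤l g using (exit; ExitForm; boundary-form)

  form : ∀ x → ExitForm (List.lookup L∂ x)
  form x = boundary-form (Equivalence.to (L∂⇔∂ _) (∈-lookup x))

  exit-kind : Fin l → Fin (length L∂) → Fin 6
  exit-kind _ x = proj₁ (proj₂ (proj₂ (form x)))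

  coset-element∈LS : ∀ j x → embed (proj₁ (form x)) ⊗ B^ (toℕ j) ∈ LS
  coset-element∈LS j x = Equivalence.from (LS⇔S _) (InS-embed⊗B^ (Finₚ.toℕ<n j) (proj₁ (proj₂ (form x))))

  coset-position : Fin l → Fin (length L∂) → Fin (length LS)
  coset-position j x = Any.index (coset-element∈LS j x)

  injective : ∀ {j x j′ x′} → exit-kind j x ≡ exit-kind j′ x′ → coset-position j x ≡ coset-position j′ x′ →
              j ≡ j′ × x ≡ x′
  injective {j} {x} {j′} {x′} same-kind same-position =
    Finₚ.toℕ-injective same-power , lookup-injective unique∂ x x′ (begin
      List.lookup L∂ x                                 ≡⟨ proj₂ (proj₂ (proj₂ (form x))) ⟩
      embed (proj₁ (form x)) ⊗ exit (exit-kind j x)    ≡⟨ cong₂ (λ E k → E ⊗ exit k) same-embed same-kind ⟩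
      embed (proj₁ (form x′)) ⊗ exit (exit-kind j′ x′) ≡⟨ proj₂ (proj₂ (proj₂ (form x′))) ⟨
      List.lookup L∂ x′                                ∎)
    where
    open ≡-Reasoning
    same-coset = index-injective (setoid _) (coset-element∈LS j x) (coset-element∈LS j′ x′) same-position
    same-power×same-embed =
      embed⊗B^-injective {proj₁ (form x)} {proj₁ (form x′)} (Finₚ.toℕ<n j) (Finₚ.toℕ<n j′) same-coset
    same-power = proj₁ same-power×same-embed
    same-embed = proj₂ same-power×same-embed
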